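{- Let $\phi(z)\in\mathbb{Q}(z)$ be conjugate over $\overline{\mathbb{Q}}$ to $\psi_2(z)=1/z^2$, and suppose $\phi$ has a 2-cycle consisting of points of $\mathbb{P}^1(\mathbb{Q})$. Then $\phi$ has either no fixed points in $\mathbb{P}^1(\mathbb{Q})$ or exactly one, and the rational preperiodic points of $\phi$ are exactly: the two points of the rational 2-cycle, together with (in the case of one rational fixed point) that fixed point and a single rational point of type $1_1$ mapping to it; there are no other points of $\mathbb{P}^1(\mathbb{Q})$ that are preperiodic for $\phi$.
   Context: Conjugate over $\overline{\mathbb{Q}}$ means $\phi=f\circ\psi_2\circ f^{ -1}$ for some $f\in\mathrm{PGL}_2(\overline{\mathbb{Q}})$. A point is preperiodic if its forward orbit is finite. A point $\alpha$ is of type $m_n$ if $\phi^n(\alpha)$ has least period $m$, with $n,m$ minimal; type $1_1$ means $\alpha$ is not fixed but $\phi(\alpha)$ is fixed. -}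

module Defs where

open import Level using (Level; _⊔_) renaming (suc to lsuc)
open import Data.Nat using (ℕ; zero; suc)
open import Data.List using (List; []; _∷_; map)
open import Data.Product using (Σ; ∃; _×_; _,_; proj₁; proj₂)
open import Data.Sum using (_⊎_)
open import Relation.Nullary using (¬_)
open import Relation.Binary.PropositionalEquality using (_≡_)
open import Algebra.Bundles using (CommutativeRing)
import Data.Rational as Q
open Q using (ℚ)

record Field (c ℓ : Level) : Set (lsuc (c ⊔ ℓ)) where
  field
    commRing : CommutativeRing c ℓ
  open CommutativeRing commRing public
  field
    0≉1   : ¬ (0# ≈ 1#)
    inv   : ∀ x → ¬ (x ≈ 0#) → ∃ λ y → x * y ≈ 1#

module _ {c ℓ} (K : Field c ℓ) where
  open Field K

  -- evaluation of the monic polynomial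
  --   a₀ + a₁ x + … + aₙ xⁿ + x^(n+1)   (coefficient list a₀ ∷ … ∷ aₙ ∷ [])
  -- at x (Horner scheme; the empty list gives the polynomial x).
  evalMonic : List Carrier → Carrier → Carrier
  evalMonic []       x = x
  evalMonic (a ∷ as) x = a + x * evalMonic as x

  AlgClosed : Set (c ⊔ ℓ)
  AlgClosed = (as : List Carrier) → ∃ λ x → evalMonic as x ≈ 0#

  -- a unital ring homomorphism ℚ → K (automatically injective)
  record RatEmbedding : Set (c ⊔ ℓ) where
    field
      ι      : ℚ → Carrier
      ι-1    : ι Q.1ℚ ≈ 1#
      ι-+    : ∀ p q → ι (p Q.+ q) ≈ ι p + ι q
      ι-*    : ∀ p q → ι (p Q.* q) ≈ ι p * ι q

record AlgebraicClosureOfℚ (c ℓ : Level) : Set (lsuc (c ⊔ ℓ)) where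
  field
    K         : Field c ℓ
    closed    : AlgClosed K
    emb       : RatEmbedding K
  open Field K public
  open RatEmbedding emb public
  field
    algebraic : ∀ x → ∃ λ (qs : List ℚ) → evalMonic K (map ι qs) x ≈ 0#

record QuadMap : Set where
  constructor quad
  field a b c d e f : ℚ

-- The rational point [x : y] of P¹(ℚ), represented by a pair (x , y)
-- with (x , y) ≠ (0 , 0).
ℚ² : Set
ℚ² = ℚ × ℚ

NonzeroQ : ℚ² → Set
NonzeroQ (x , y) = ¬ (x ≡ Q.0ℚ × y ≡ Q.0ℚ)

_∼_ : ℚ² → ℚ² → Set
(x , y) ∼ (x' , y') = x Q.* y' ≡ x' Q.* y

applyQ : QuadMap → ℚ² → ℚ²
applyQ (quad a b c d e f) (x , y) =
  ( a Q.* (x Q.* x) Q.+ b Q.* (x Q.* y) Q.+ c Q.* (y Q.* y)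
  , d Q.* (x Q.* x) Q.+ e Q.* (x Q.* y) Q.+ f Q.* (y Q.* y) )

iterQ : QuadMap → ℕ → ℚ² → ℚ²
iterQ φ zero    P = P
iterQ φ (suc n) P = applyQ φ (iterQ φ n P)

Preperiodic : QuadMap → ℚ² → Set
Preperiodic φ P = ∃ λ m → ∃ λ n → ¬ (m ≡ n) × (iterQ φ m P ∼ iterQ φ n P)

Fixed : QuadMap → ℚ² → Set
Fixed φ P = applyQ φ P ∼ P

module _ {c ℓ} (Kb : AlgebraicClosureOfℚ c ℓ) where
  open AlgebraicClosureOfℚ Kb

  K² : Set c
  K² = Carrier × Carrier

  NonzeroK : K² → Set ℓ
  NonzeroK (x , y) = ¬ (x ≈ 0# × y ≈ 0#)

  _∼K_ : K² → K² → Set ℓ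
  (x , y) ∼K (x' , y') = x * y' ≈ x' * y

  applyK : QuadMap → K² → K²
  applyK (quad a b c d e f) (x , y) =
    ( ι a * (x * x) + ι b * (x * y) + ι c * (y * y)
    , ι d * (x * x) + ι e * (x * y) + ι f * (y * y) )

  ψ₂ : K² → K²
  ψ₂ (x , y) = (y * y , x * x)

  -- f = [[α β],[γ δ]] ∈ PGL₂(K) : [X:Y] ↦ [αX + βY : γX + δY]
  applyM : Carrier → Carrier → Carrier → Carrier → K² → K²
  applyM α β γ δ (x , y) = (α * x + β * y , γ * x + δ * y)

  -- φ is a genuine morphism of P¹ given by the two forms, i.e. the forms
  -- have no common zero in P¹(K) (the representation is in lowest terms).
  NoCommonZero : QuadMap → Set (c ⊔ ℓ)
  NoCommonZero φ = ∀ P → NonzeroK P → NonzeroK (applyK φ P)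

  -- φ = f ∘ ψ₂ ∘ f⁻¹ for some f ∈ PGL₂(K), i.e. φ ∘ f = f ∘ ψ₂ on P¹(K).
  ConjugateToψ₂ : QuadMap → Set (c ⊔ ℓ)
  ConjugateToψ₂ φ =
    ∃ λ α → ∃ λ β → ∃ λ γ → ∃ λ δ →
      ¬ (α * δ - β * γ ≈ 0#) ×
      (∀ P → NonzeroK P →
        applyK φ (applyM α β γ δ P) ∼K applyM α β γ δ (ψ₂ P))

{-# OPTIONS --safe #-}
module Submission where

-- Over Q̄, φ is conjugate to ψ₂ = 1/z², whose only 2-cycle is {0, ∞}, both points totally
-- ramified; so P and Q are each other's only preimages. A rational change of coordinates moving
-- P, Q to ∞, 0 then turns φ into z ↦ c / (d z²) with c, d ≠ 0. For this map the ratio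
-- r = d s³ / (c t³) of a point [s : t] transforms as r ↦ r⁻², and r² + r⁻² grows strictly along
-- an orbit unless r = ±1. Hence the rational preperiodic points besides ∞ and 0 satisfy
-- d s³ = ± c t³: the fixed point [x : 1] with d x³ = c, and its other preimage [-x : 1]. Whether
-- such a rational x exists is decided by a finite search bounded by the rational root theorem.

open import Defs
open import Level using (Level; 0ℓ)
open import Data.Nat as ℕ using (ℕ; zero; suc)
import Data.Nat.Properties as ℕP
open import Data.Nat.Divisibility using (_∣_; ∣-trans; ∣⇒≤; m∣m*n; ∣m⇒∣m*n; ∣n⇒∣m*n)
open import Data.Nat.Coprimality as Coprimality using (Coprime; coprime-divisor)
import Data.Nat.Tactic.RingSolver as ℕSolver
open import Data.Integer as ℤ using (∣_∣)
import Data.Integer.Properties as ℤP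
import Data.Rational as ℚ
import Data.Rational.Properties as ℚP
import Data.Rational.Unnormalised as ℚᵘ
import Data.Rational.Unnormalised.Properties as ℚᵘP
open import Data.Fin using (Fin; toℕ; fromℕ<)
import Data.Fin.Properties as FinP
open import Data.Bool using (Bool; true; false)
open import Data.Maybe using (Maybe; just; nothing)
open import Data.Product using (∃; _×_; _,_; proj₁; proj₂)
open import Data.Product.Relation.Binary.Pointwise.NonDependent using (Pointwise)
open import Data.Sum using (_⊎_; inj₁; inj₂; map)
open import Data.Empty using (⊥; ⊥-elim)
open import Function using (_∘_)
open import Relation.Nullary using (¬_; Dec; yes; no)
open import Relation.Nullary.Decidable using (_⊎-dec_)
open import Relation.Binary.Definitions using (tri<; tri≈; tri>)
import Relation.Binary.PropositionalEquality as ≡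
import Algebra.Properties.Ring as RingProperties
import Algebra.Solver.Ring as RingSolver
import Algebra.Solver.Ring.AlmostCommutativeRing as ACR
open import Tactic.RingSolver using (solve-∀)
open import Tactic.RingSolver.Core.AlmostCommutativeRing using (AlmostCommutativeRing; fromCommutativeRing)

module FieldProperties {c ℓ} (F : Field c ℓ) where
  open Field F
  open import Relation.Binary.Reasoning.Setoid setoid

  *-cancelˡ : ∀ {a x y} → ¬ a ≈ 0# → a * x ≈ a * y → x ≈ y
  *-cancelˡ {a} {x} {y} a≉0 ax≈ay with inv a a≉0
  ... | a⁻¹ , aa⁻¹≈1 = begin
    x              ≈⟨ sym (*-identityˡ x) ⟩
    1# * x         ≈⟨ *-congʳ (sym a⁻¹a≈1) ⟩
    (a⁻¹ * a) * x  ≈⟨ *-assoc a⁻¹ a x ⟩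
    a⁻¹ * (a * x)  ≈⟨ *-congˡ ax≈ay ⟩
    a⁻¹ * (a * y)  ≈⟨ sym (*-assoc a⁻¹ a y) ⟩
    (a⁻¹ * a) * y  ≈⟨ *-congʳ a⁻¹a≈1 ⟩
    1# * y         ≈⟨ *-identityˡ y ⟩
    y              ∎
    where a⁻¹a≈1 : a⁻¹ * a ≈ 1#
          a⁻¹a≈1 = trans (*-comm a⁻¹ a) aa⁻¹≈1

  x≉0∧x*y≈0⇒y≈0 : ∀ {x y} → ¬ x ≈ 0# → x * y ≈ 0# → y ≈ 0#
  x≉0∧x*y≈0⇒y≈0 {x} x≉0 xy≈0 = *-cancelˡ x≉0 (trans xy≈0 (sym (zeroʳ x)))

  y≉0∧x*y≈0⇒x≈0 : ∀ {x y} → ¬ y ≈ 0# → x * y ≈ 0# → x ≈ 0#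
  y≉0∧x*y≈0⇒x≈0 {x} {y} y≉0 xy≈0 = x≉0∧x*y≈0⇒y≈0 y≉0 (trans (*-comm y x) xy≈0)

  x≉0∧y≉0⇒xy≉0 : ∀ {x y} → ¬ x ≈ 0# → ¬ y ≈ 0# → ¬ x * y ≈ 0#
  x≉0∧y≉0⇒xy≉0 x≉0 y≉0 xy≈0 = y≉0 (x≉0∧x*y≈0⇒y≈0 x≉0 xy≈0)

ℚ-field : Field 0ℓ 0ℓ
ℚ-field = record
  { commRing = ℚP.+-*-commutativeRing
  ; 0≉1      = λ 0≡1 → ℚP.1≢0 (≡.sym 0≡1)
  ; inv      = λ x x≢0 → let instance _ = ℚ.≢-nonZero x≢0 in ℚ.1/ x , ℚP.*-inverseʳ x
  }

_∼?_ : ∀ R S → Dec (R ∼ S)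
(x , y) ∼? (x′ , y′) = x ℚ.* y′ ℚP.≟ x′ ℚ.* y

-- Over Q̄: P and Q are each other's only preimages

module OverAlgebraicClosure {c ℓ} (Q̄ : AlgebraicClosureOfℚ c ℓ) where
  open AlgebraicClosureOfℚ Q̄
  open FieldProperties K
  open RingProperties ring
    using (x∙y⁻¹≈ε⇒x≈y; x≈y⇒x∙y⁻¹≈ε; x+x≈x⇒x≈0; +-inverseʳ-unique)
  open import Relation.Binary.Reasoning.Setoid setoid

  ι-0 : ι ℚ.0ℚ ≈ 0#
  ι-0 = x+x≈x⇒x≈0 (ι ℚ.0ℚ) (sym (ι-+ ℚ.0ℚ ℚ.0ℚ))

  ι-neg : ∀ p → ι (ℚ.- p) ≈ - ι p
  ι-neg p = +-inverseʳ-unique (ι p) (ι (ℚ.- p))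
    (trans (sym (ι-+ p (ℚ.- p))) (trans (reflexive (≡.cong ι (ℚP.+-inverseʳ p))) ι-0))

  ι-≉0 : ∀ {p} → ¬ p ≡.≡ ℚ.0ℚ → ¬ ι p ≈ 0#
  ι-≉0 {p} p≢0 ιp≈0 with Field.inv ℚ-field p p≢0
  ... | p⁻¹ , pp⁻¹≡1 = 0≉1 (begin
    0#             ≈⟨ sym (zeroʳ (ι p⁻¹)) ⟩
    ι p⁻¹ * 0#     ≈⟨ *-congˡ (sym ιp≈0) ⟩
    ι p⁻¹ * ι p    ≈⟨ sym (ι-* p⁻¹ p) ⟩
    ι (p⁻¹ ℚ.* p)  ≈⟨ reflexive (≡.cong ι (≡.trans (ℚP.*-comm p⁻¹ p) pp⁻¹≡1)) ⟩
    ι ℚ.1ℚ         ≈⟨ ι-1 ⟩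
    1#             ∎)

  ι≈0⇒≡0 : ∀ {p} → ι p ≈ 0# → p ≡.≡ ℚ.0ℚ
  ι≈0⇒≡0 {p} ιp≈0 with p ℚP.≟ ℚ.0ℚ
  ... | yes p≡0 = p≡0
  ... | no p≢0  = ⊥-elim (ι-≉0 p≢0 ιp≈0)

  ι-injective : ∀ {p q} → ι p ≈ ι q → p ≡.≡ q
  ι-injective {p} {q} ιp≈ιq = ℚRing.x∙y⁻¹≈ε⇒x≈y p q (ι≈0⇒≡0 (begin
    ι (p ℚ.- q)      ≈⟨ ι-+ p (ℚ.- q) ⟩
    ι p + ι (ℚ.- q)  ≈⟨ +-cong ιp≈ιq (ι-neg q) ⟩
    ι q - ι q        ≈⟨ x≈y⇒x∙y⁻¹≈ε refl ⟩
    0#               ∎))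
    where module ℚRing = RingProperties ℚP.+-*-ring

  private
    ι-homomorphism : ℚ.+-*-rawRing ACR.-Raw-AlmostCommutative⟶ ACR.fromCommutativeRing commRing
    ι-homomorphism = record
      { ⟦_⟧ = ι ; +-homo = ι-+ ; *-homo = ι-* ; -‿homo = ι-neg ; 0-homo = ι-0 ; 1-homo = ι-1 }

    ι-image≟ : ∀ p q → Maybe (ι p ≈ ι q)
    ι-image≟ p q with p ℚP.≟ q
    ... | yes ≡.refl = just refl
    ... | no _       = nothing

  open RingSolver ℚ.+-*-rawRing (ACR.fromCommutativeRing commRing) ι-homomorphism ι-image≟
    using (solve; _:=_; _:+_; _:*_; _:-_)

  Point : Set c
  Point = K² Q̄

  _~_ : Point → Point → Set ℓ
  _~_ = _∼K_ Q̄

  Nonzero : Point → Set ℓ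
  Nonzero = NonzeroK Q̄

  _≋_ : Point → Point → Set ℓ
  _≋_ = Pointwise _≈_ _≈_

  infix 4 _~_ _≋_
  infixr 7 _·_

  _·_ : Carrier → Point → Point
  λ′ · (x , y) = (λ′ * x , λ′ * y)

  det : Point → Point → Carrier
  det (x , y) (x′ , y′) = x * y′ - x′ * y

  ~⇒det≈0 : ∀ v w → v ~ w → det v w ≈ 0#
  ~⇒det≈0 (x , y) (x′ , y′) = x≈y⇒x∙y⁻¹≈ε

  det≈0⇒~ : ∀ v w → det v w ≈ 0# → v ~ w
  det≈0⇒~ (x , y) (x′ , y′) = x∙y⁻¹≈ε⇒x≈y (x * y′) (x′ * y)

  ~-sym : ∀ {v w} → v ~ w → w ~ v
  ~-sym = sym

  ~-resp-≋ : ∀ {v v′ w w′} → v ≋ v′ → w ≋ w′ → v ~ w → v′ ~ w′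
  ~-resp-≋ (x≈ , y≈) (x′≈ , y′≈) xy′≈x′y =
    trans (*-cong (sym x≈) (sym y′≈)) (trans xy′≈x′y (*-cong x′≈ y≈))

  ·-reflects-~ˡ : ∀ {λ′} v w → ¬ λ′ ≈ 0# → (λ′ · v) ~ w → v ~ w
  ·-reflects-~ˡ {λ′} (x , y) (x′ , y′) λ≉0 λxy′≈x′λy = *-cancelˡ λ≉0 (begin
    λ′ * (x * y′)   ≈⟨ sym (*-assoc λ′ x y′) ⟩
    λ′ * x * y′     ≈⟨ λxy′≈x′λy ⟩
    x′ * (λ′ * y)   ≈⟨ solve 3 (λ λ′ x′ y → x′ :* (λ′ :* y) := λ′ :* (x′ :* y)) refl λ′ x′ y ⟩
    λ′ * (x′ * y)   ∎)

  ·-reflects-~ʳ : ∀ {λ′} v w → ¬ λ′ ≈ 0# → v ~ (λ′ · w) → v ~ w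
  ·-reflects-~ʳ v w λ≉0 v~λw = ~-sym (·-reflects-~ˡ w v λ≉0 (~-sym v~λw))

  linear-combination≈0 : ∀ a b {x y} → x ≈ 0# → y ≈ 0# → a * x - b * y ≈ 0#
  linear-combination≈0 a b x≈0 y≈0 = x≈y⇒x∙y⁻¹≈ε (begin
    a * _   ≈⟨ *-congˡ x≈0 ⟩
    a * 0#  ≈⟨ zeroʳ a ⟩
    0#      ≈⟨ sym (zeroʳ b) ⟩
    b * 0#  ≈⟨ *-congˡ (sym y≈0) ⟩
    b * _   ∎)

  ¬¬-~-trans-via-nonzero : ∀ u v w → Nonzero u → u ~ v → u ~ w → ¬ ¬ (v ~ w)
  ¬¬-~-trans-via-nonzero u@(u₁ , u₂) v@(v₁ , v₂) w@(w₁ , w₂) u≉0 u~v u~w v≁w =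
    u≉0 (y≉0∧x*y≈0⇒x≈0 Δ≉0 u₁Δ≈0 , y≉0∧x*y≈0⇒x≈0 Δ≉0 u₂Δ≈0)
    where
    Δ : Carrier
    Δ = det v w
    Δ≉0 : ¬ Δ ≈ 0#
    Δ≉0 Δ≈0 = v≁w (det≈0⇒~ v w Δ≈0)
    uw≈0 : det u w ≈ 0#
    uw≈0 = ~⇒det≈0 u w u~w
    uv≈0 : det u v ≈ 0#
    uv≈0 = ~⇒det≈0 u v u~v
    u₁Δ≈0 : u₁ * Δ ≈ 0#
    u₁Δ≈0 = begin
      u₁ * Δ                        ≈⟨ solve 6 (λ u₁ u₂ v₁ v₂ w₁ w₂ →
                                         u₁ :* (v₁ :* w₂ :- w₁ :* v₂)
                                         := v₁ :* (u₁ :* w₂ :- w₁ :* u₂) :- w₁ :* (u₁ :* v₂ :- v₁ :* u₂))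
                                         refl u₁ u₂ v₁ v₂ w₁ w₂ ⟩
      v₁ * det u w - w₁ * det u v   ≈⟨ linear-combination≈0 v₁ w₁ uw≈0 uv≈0 ⟩
      0#                            ∎
    u₂Δ≈0 : u₂ * Δ ≈ 0#
    u₂Δ≈0 = begin
      u₂ * Δ                        ≈⟨ solve 6 (λ u₁ u₂ v₁ v₂ w₁ w₂ →
                                         u₂ :* (v₁ :* w₂ :- w₁ :* v₂)
                                         := v₂ :* (u₁ :* w₂ :- w₁ :* u₂) :- w₂ :* (u₁ :* v₂ :- v₁ :* u₂))
                                         refl u₁ u₂ v₁ v₂ w₁ w₂ ⟩
      v₂ * det u w - w₂ * det u v   ≈⟨ linear-combination≈0 v₂ w₂ uw≈0 uv≈0 ⟩
      0#                            ∎

  x*x≈0⇒¬¬x≈0 : ∀ {x} → x * x ≈ 0# → ¬ ¬ x ≈ 0#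
  x*x≈0⇒¬¬x≈0 xx≈0 x≉0 = x≉0∧y≉0⇒xy≉0 x≉0 x≉0 xx≈0

  x≈0⇒x*y≈0 : ∀ {x} y → x ≈ 0# → x * y ≈ 0#
  x≈0⇒x*y≈0 y x≈0 = trans (*-congʳ x≈0) (zeroˡ y)

  y≈0⇒x*y≈0 : ∀ x {y} → y ≈ 0# → x * y ≈ 0#
  y≈0⇒x*y≈0 x y≈0 = trans (*-congˡ y≈0) (zeroʳ x)

  -- The only 2-cycle of ψ₂ is {0, ∞}, and both points are totally ramified. Equality in K is
  -- not decidable, so the case analysis on vanishing coordinates happens under ¬ ¬.
  ψ₂-two-cycle-unique-preimage : ∀ u v a → Nonzero u → Nonzero v →
    v ~ ψ₂ Q̄ u → u ~ ψ₂ Q̄ v → v ~ ψ₂ Q̄ a → ¬ u ~ v → ¬ ¬ (a ~ u)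
  ψ₂-two-cycle-unique-preimage (x , y) (z , w) (s , t) u≉0 v≉0 zxx≈yyw xzz≈wwy zss≈ttw u≁v a≁u =
    u≁v (x∙y⁻¹≈ε⇒x≈y (x * w) (z * y) (x≉0∧x*y≈0⇒y≈0 (x≉0∧y≉0⇒xy≉0 x≉0 x≉0) xx[xw-zy]≈0))
    where
    a≁u-by-zeros : s * y ≈ 0# → x * t ≈ 0# → ⊥
    a≁u-by-zeros sy≈0 xt≈0 = a≁u (trans sy≈0 (sym xt≈0))

    z≉0 : ¬ z ≈ 0#
    z≉0 z≈0 =
      x*x≈0⇒¬¬x≈0 (y≉0∧x*y≈0⇒x≈0 (λ w≈0 → v≉0 (z≈0 , w≈0)) (trans (sym zxx≈yyw) (x≈0⇒x*y≈0 (x * x) z≈0))) λ y≈0 →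
      x*x≈0⇒¬¬x≈0 (y≉0∧x*y≈0⇒x≈0 (λ w≈0 → v≉0 (z≈0 , w≈0)) (trans (sym zss≈ttw) (x≈0⇒x*y≈0 (s * s) z≈0))) λ t≈0 →
      a≁u-by-zeros (y≈0⇒x*y≈0 s y≈0) (y≈0⇒x*y≈0 x t≈0)

    w≉0 : ¬ w ≈ 0#
    w≉0 w≈0 =
      x*x≈0⇒¬¬x≈0 (x≉0∧x*y≈0⇒y≈0 z≉0 (trans zxx≈yyw (y≈0⇒x*y≈0 (y * y) w≈0))) λ x≈0 →
      x*x≈0⇒¬¬x≈0 (x≉0∧x*y≈0⇒y≈0 z≉0 (trans zss≈ttw (y≈0⇒x*y≈0 (t * t) w≈0))) λ s≈0 →
      a≁u-by-zeros (x≈0⇒x*y≈0 y s≈0) (x≈0⇒x*y≈0 t x≈0)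

    x≉0 : ¬ x ≈ 0#
    x≉0 x≈0 =
      x*x≈0⇒¬¬x≈0 (y≉0∧x*y≈0⇒x≈0 w≉0 (trans (sym zxx≈yyw) (y≈0⇒x*y≈0 z (x≈0⇒x*y≈0 x x≈0)))) λ y≈0 →
      u≉0 (x≈0 , y≈0)

    y≉0 : ¬ y ≈ 0#
    y≉0 y≈0 = x≉0∧y≉0⇒xy≉0 x≉0 x≉0
      (x≉0∧x*y≈0⇒y≈0 z≉0 (trans zxx≈yyw (x≈0⇒x*y≈0 w (x≈0⇒x*y≈0 y y≈0))))

    x³≈y³ : x * (x * x) ≈ y * (y * y)
    x³≈y³ = *-cancelˡ (x≉0∧y≉0⇒xy≉0 (x≉0∧y≉0⇒xy≉0 w≉0 w≉0) y≉0) (begin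
      w * w * y * (x * (x * x))       ≈⟨ *-congʳ (sym xzz≈wwy) ⟩
      x * (z * z) * (x * (x * x))     ≈⟨ solve 2 (λ x z → x :* (z :* z) :* (x :* (x :* x))
                                           := (z :* (x :* x)) :* (z :* (x :* x))) refl x z ⟩
      (z * (x * x)) * (z * (x * x))   ≈⟨ *-cong zxx≈yyw zxx≈yyw ⟩
      (y * y * w) * (y * y * w)       ≈⟨ solve 2 (λ y w → (y :* y :* w) :* (y :* y :* w)
                                           := w :* w :* y :* (y :* (y :* y))) refl y w ⟩
      w * w * y * (y * (y * y))       ∎)

    xx[xw-zy]≈0 : x * x * (x * w - z * y) ≈ 0#
    xx[xw-zy]≈0 = begin
      x * x * (x * w - z * y)               ≈⟨ solve 4 (λ x y z w → x :* x :* (x :* w :- z :* y)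
                                                 := w :* (x :* (x :* x)) :- z :* (x :* x) :* y) refl x y z w ⟩
      w * (x * (x * x)) - z * (x * x) * y   ≈⟨ +-congˡ (-‿cong (*-congʳ zxx≈yyw)) ⟩
      w * (x * (x * x)) - y * y * w * y     ≈⟨ solve 3 (λ x y w → w :* (x :* (x :* x)) :- y :* y :* w :* y
                                                 := w :* (x :* (x :* x) :- y :* (y :* y))) refl x y w ⟩
      w * (x * (x * x) - y * (y * y))       ≈⟨ y≈0⇒x*y≈0 w (x≈y⇒x∙y⁻¹≈ε x³≈y³) ⟩
      0#                                    ∎

  ≋-refl : ∀ {v} → v ≋ v
  ≋-refl = refl , refl

  ≋-sym : ∀ {v w} → v ≋ w → w ≋ v
  ≋-sym (x≈ , y≈) = sym x≈ , sym y≈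

  ≋-trans : ∀ {u v w} → u ≋ v → v ≋ w → u ≋ w
  ≋-trans (x≈ , y≈) (x≈′ , y≈′) = trans x≈ x≈′ , trans y≈ y≈′

  applyK-cong : ∀ φ {v w} → v ≋ w → applyK Q̄ φ v ≋ applyK Q̄ φ w
  applyK-cong (quad a b c d e f) {x , y} {x′ , y′} (x≈ , y≈) = form-cong (ι a) (ι b) (ι c) , form-cong (ι d) (ι e) (ι f)
    where form-cong : ∀ a b c → a * (x * x) + b * (x * y) + c * (y * y) ≈ a * (x′ * x′) + b * (x′ * y′) + c * (y′ * y′)
          form-cong a b c = +-cong (+-cong (*-congˡ (*-cong x≈ x≈)) (*-congˡ (*-cong x≈ y≈))) (*-congˡ (*-cong y≈ y≈))

  applyK-homogeneous : ∀ φ λ′ v → applyK Q̄ φ (λ′ · v) ≋ (λ′ * λ′) · applyK Q̄ φ v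
  applyK-homogeneous (quad a b c d e f) λ′ (x , y) = quadratic-form (ι a) (ι b) (ι c) , quadratic-form (ι d) (ι e) (ι f)
    where
    quadratic-form : ∀ a b c → a * ((λ′ * x) * (λ′ * x)) + b * ((λ′ * x) * (λ′ * y)) + c * ((λ′ * y) * (λ′ * y))
                               ≈ (λ′ * λ′) * (a * (x * x) + b * (x * y) + c * (y * y))
    quadratic-form a b c = solve 6 (λ a b c λ′ x y →
      a :* ((λ′ :* x) :* (λ′ :* x)) :+ b :* ((λ′ :* x) :* (λ′ :* y)) :+ c :* ((λ′ :* y) :* (λ′ :* y))
      := (λ′ :* λ′) :* (a :* (x :* x) :+ b :* (x :* y) :+ c :* (y :* y))) refl a b c λ′ x y

  module Conjugacy (α β γ δ : Carrier) (D≉0 : ¬ α * δ - β * γ ≈ 0#) where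
    D : Carrier
    D = α * δ - β * γ

    M : Point → Point
    M = applyM Q̄ α β γ δ

    adj : Point → Point
    adj (x , y) = (δ * x - β * y , α * y - γ * x)

    M∘adj : ∀ v → M (adj v) ≋ D · v
    M∘adj (x , y) =
        solve 6 (λ α β γ δ x y → α :* (δ :* x :- β :* y) :+ β :* (α :* y :- γ :* x) := (α :* δ :- β :* γ) :* x) refl α β γ δ x y
      , solve 6 (λ α β γ δ x y → γ :* (δ :* x :- β :* y) :+ δ :* (α :* y :- γ :* x) := (α :* δ :- β :* γ) :* y) refl α β γ δ x y

    adj∘M : ∀ v → adj (M v) ≋ D · v
    adj∘M (x , y) =
        solve 6 (λ α β γ δ x y → δ :* (α :* x :+ β :* y) :- β :* (γ :* x :+ δ :* y) := (α :* δ :- β :* γ) :* x) refl α β γ δ x y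
      , solve 6 (λ α β γ δ x y → α :* (γ :* x :+ δ :* y) :- γ :* (α :* x :+ β :* y) := (α :* δ :- β :* γ) :* y) refl α β γ δ x y

    adj-· : ∀ λ′ v → adj (λ′ · v) ≋ λ′ · adj v
    adj-· λ′ (x , y) =
        solve 5 (λ β δ λ′ x y → δ :* (λ′ :* x) :- β :* (λ′ :* y) := λ′ :* (δ :* x :- β :* y)) refl β δ λ′ x y
      , solve 5 (λ α γ λ′ x y → α :* (λ′ :* y) :- γ :* (λ′ :* x) := λ′ :* (α :* y :- γ :* x)) refl α γ λ′ x y

    det-adj : ∀ v w → det (adj v) (adj w) ≈ D * det v w
    det-adj (x , y) (x′ , y′) = solve 8 (λ α β γ δ x y x′ y′ →
      (δ :* x :- β :* y) :* (α :* y′ :- γ :* x′) :- (δ :* x′ :- β :* y′) :* (α :* y :- γ :* x)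
      := (α :* δ :- β :* γ) :* (x :* y′ :- x′ :* y)) refl α β γ δ x y x′ y′

    adj-~ : ∀ {v w} → v ~ w → adj v ~ adj w
    adj-~ {v} {w} v~w = det≈0⇒~ (adj v) (adj w)
      (trans (det-adj v w) (y≈0⇒x*y≈0 D (~⇒det≈0 v w v~w)))

    adj-reflects-~ : ∀ {v w} → adj v ~ adj w → v ~ w
    adj-reflects-~ {v} {w} adjv~adjw = det≈0⇒~ v w
      (x≉0∧x*y≈0⇒y≈0 D≉0 (trans (sym (det-adj v w)) (~⇒det≈0 (adj v) (adj w) adjv~adjw)))

    adj-nonzero : ∀ {v} → Nonzero v → Nonzero (adj v)
    adj-nonzero {v} v≉0 (adj₁≈0 , adj₂≈0) = v≉0
      ( x≉0∧x*y≈0⇒y≈0 D≉0 (trans (sym (proj₁ (M∘adj v))) (combination≈0 α β adj₁≈0 adj₂≈0))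
      , x≉0∧x*y≈0⇒y≈0 D≉0 (trans (sym (proj₂ (M∘adj v))) (combination≈0 γ δ adj₁≈0 adj₂≈0)) )
      where combination≈0 : ∀ a b {x y} → x ≈ 0# → y ≈ 0# → a * x + b * y ≈ 0#
            combination≈0 a b x≈0 y≈0 = trans (+-cong (y≈0⇒x*y≈0 a x≈0) (y≈0⇒x*y≈0 b y≈0)) (+-identityʳ 0#)

    -- adj is M⁻¹ up to the scalar D, so φ ∘ M ~ M ∘ ψ₂ turns into adj ∘ φ ~ ψ₂ ∘ adj.
    adj-intertwines : ∀ φ → (∀ P → Nonzero P → applyK Q̄ φ (M P) ~ M (ψ₂ Q̄ P)) →
      ∀ r → Nonzero r → adj (applyK Q̄ φ r) ~ ψ₂ Q̄ (adj r)
    adj-intertwines φ φM~Mψ₂ r r≉0 =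
      ·-reflects-~ʳ (adj (applyK Q̄ φ r)) (ψ₂ Q̄ (adj r)) D≉0
        (·-reflects-~ˡ (adj (applyK Q̄ φ r)) (D · ψ₂ Q̄ (adj r)) (x≉0∧y≉0⇒xy≉0 D≉0 D≉0)
          (~-resp-≋ (adj-· (D * D) (applyK Q̄ φ r)) (adj∘M (ψ₂ Q̄ (adj r)))
            (adj-~ (~-resp-≋ φMadj≋DDφ ≋-refl (φM~Mψ₂ (adj r) (adj-nonzero r≉0))))))
      where
      φMadj≋DDφ : applyK Q̄ φ (M (adj r)) ≋ (D * D) · applyK Q̄ φ r
      φMadj≋DDφ = ≋-trans (applyK-cong φ (M∘adj r)) (applyK-homogeneous φ D r)

  ι² : ℚ² → Point
  ι² (x , y) = (ι x , ι y)

  ι²-nonzero : ∀ {R} → NonzeroQ R → Nonzero (ι² R)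
  ι²-nonzero R≢0 (ιx≈0 , ιy≈0) = R≢0 (ι≈0⇒≡0 ιx≈0 , ι≈0⇒≡0 ιy≈0)

  ι²-~ : ∀ {R S} → R ∼ S → ι² R ~ ι² S
  ι²-~ {x , y} {x′ , y′} xy′≡x′y = trans (sym (ι-* x y′)) (trans (reflexive (≡.cong ι xy′≡x′y)) (ι-* x′ y))

  ι²-reflects-~ : ∀ {R S} → ι² R ~ ι² S → R ∼ S
  ι²-reflects-~ {x , y} {x′ , y′} ιxιy′≈ιx′ιy = ι-injective (trans (ι-* x y′) (trans ιxιy′≈ιx′ιy (sym (ι-* x′ y))))

  applyK-ι² : ∀ φ R → applyK Q̄ φ (ι² R) ≋ ι² (applyQ φ R)
  applyK-ι² (quad a b c d e f) (x , y) = sym (ι-form a b c) , sym (ι-form d e f)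
    where
    ι-monomial : ∀ a x y → ι (a ℚ.* (x ℚ.* y)) ≈ ι a * (ι x * ι y)
    ι-monomial a x y = trans (ι-* a _) (*-congˡ (ι-* x y))
    ι-form : ∀ a b c → ι (a ℚ.* (x ℚ.* x) ℚ.+ b ℚ.* (x ℚ.* y) ℚ.+ c ℚ.* (y ℚ.* y))
                       ≈ ι a * (ι x * ι x) + ι b * (ι x * ι y) + ι c * (ι y * ι y)
    ι-form a b c = trans (ι-+ _ _)
      (+-cong (trans (ι-+ _ _) (+-cong (ι-monomial a x x) (ι-monomial b x y))) (ι-monomial c y y))

  -- adj ∘ ι carries the rational 2-cycle {P, Q} and a preimage A of Q to the same configuration for ψ₂.
  two-cycle-unique-preimage : ∀ φ → NoCommonZero Q̄ φ → ConjugateToψ₂ Q̄ φ →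
    ∀ P Q → NonzeroQ P → NonzeroQ Q → ¬ P ∼ Q → applyQ φ P ∼ Q → applyQ φ Q ∼ P →
    ∀ A → NonzeroQ A → applyQ φ A ∼ Q → A ∼ P
  two-cycle-unique-preimage φ φ≉0 (α , β , γ , δ , D≉0 , φM~Mψ₂) P Q P≢0 Q≢0 P≁Q φP∼Q φQ∼P A A≢0 φA∼Q
    with A ∼? P
  ... | yes A∼P = A∼P
  ... | no  A≁P = ⊥-elim (
    adj-image P Q P≢0 φP∼Q λ v~ψ₂u →
    adj-image Q P Q≢0 φQ∼P λ u~ψ₂v →
    adj-image A Q A≢0 φA∼Q λ v~ψ₂a →
    ψ₂-two-cycle-unique-preimage (adj (ι² P)) (adj (ι² Q)) (adj (ι² A))
      (adj-nonzero (ι²-nonzero P≢0)) (adj-nonzero (ι²-nonzero Q≢0)) v~ψ₂u u~ψ₂v v~ψ₂a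
      (λ u~v → P≁Q (ι²-reflects-~ (adj-reflects-~ u~v)))
      (λ a~u → A≁P (ι²-reflects-~ (adj-reflects-~ a~u))))
    where
    open Conjugacy α β γ δ D≉0
    adj-image : ∀ R S → NonzeroQ R → applyQ φ R ∼ S → ¬ ¬ (adj (ι² S) ~ ψ₂ Q̄ (adj (ι² R)))
    adj-image R S R≢0 φR∼S = ¬¬-~-trans-via-nonzero (adj (applyK Q̄ φ (ι² R))) (adj (ι² S)) (ψ₂ Q̄ (adj (ι² R)))
      (adj-nonzero (φ≉0 (ι² R) (ι²-nonzero R≢0)))
      (adj-~ (~-resp-≋ (≋-sym (applyK-ι² φ R)) ≋-refl (ι²-~ φR∼S)))
      (adj-intertwines φ φM~Mψ₂ (ι² R) (ι²-nonzero R≢0))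

  NoCommonZero⇒nonzero-on-ℚ : ∀ φ → NoCommonZero Q̄ φ → ∀ R → NonzeroQ R → NonzeroQ (applyQ φ R)
  NoCommonZero⇒nonzero-on-ℚ φ φ≉0 R R≢0 (φR₁≡0 , φR₂≡0) = φ≉0 (ι² R) (ι²-nonzero R≢0)
    ( trans (proj₁ (applyK-ι² φ R)) (trans (reflexive (≡.cong ι φR₁≡0)) ι-0)
    , trans (proj₂ (applyK-ι² φ R)) (trans (reflexive (≡.cong ι φR₂≡0)) ι-0) )

open import Data.Rational using (ℚ; 0ℚ; 1ℚ; _+_; _*_; -_; _-_; _<_; _≤_; ↥_; ↧_; ↧ₙ_)
open import Relation.Binary.PropositionalEquality
open FieldProperties ℚ-field
open RingProperties ℚP.+-*-ring using (x∙y⁻¹≈ε⇒x≈y; x≈y⇒x∙y⁻¹≈ε)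

ℚ-ring : AlmostCommutativeRing 0ℓ 0ℓ
ℚ-ring = fromCommutativeRing ℚP.+-*-commutativeRing isZero?
  where
  isZero? : ∀ x → Maybe (0ℚ ≡ x)
  isZero? x with 0ℚ ℚP.≟ x
  ... | yes 0≡x = just 0≡x
  ... | no _    = nothing

two : ℚ
two = 1ℚ + 1ℚ

cube : ℚ → ℚ
cube x = x * (x * x)

xy≡0⇒x≡0∨y≡0 : ∀ {x y} → x * y ≡ 0ℚ → x ≡ 0ℚ ⊎ y ≡ 0ℚ
xy≡0⇒x≡0∨y≡0 {x} xy≡0 with x ℚP.≟ 0ℚ
... | yes x≡0 = inj₁ x≡0
... | no  x≢0 = inj₂ (x≉0∧x*y≈0⇒y≈0 x≢0 xy≡0)

x*x≡1⇒x≡1∨x≡-1 : ∀ {x} → x * x ≡ 1ℚ → x ≡ 1ℚ ⊎ x ≡ - 1ℚ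
x*x≡1⇒x≡1∨x≡-1 {x} xx≡1 with xy≡0⇒x≡0∨y≡0 (trans (factor x) (x≈y⇒x∙y⁻¹≈ε xx≡1))
  where factor : ∀ x → (x - 1ℚ) * (x + 1ℚ) ≡ x * x - 1ℚ
        factor = solve-∀ ℚ-ring
... | inj₁ x-1≡0 = inj₁ (x∙y⁻¹≈ε⇒x≈y x 1ℚ x-1≡0)
... | inj₂ x+1≡0 = inj₂ (x∙y⁻¹≈ε⇒x≈y x (- 1ℚ) (trans (cong (x +_) (RingProperties.-‿involutive ℚP.+-*-ring 1ℚ)) x+1≡0))

x≢0⇒0<x*x : ∀ {x} → x ≢ 0ℚ → 0ℚ < x * x
x≢0⇒0<x*x {x} x≢0 with ℚP.<-cmp x 0ℚ
... | tri< x<0 _ _ = ℚP.positive⁻¹ _ {{ℚP.neg*neg⇒pos x {{ℚ.negative x<0}} x {{ℚ.negative x<0}}}}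
... | tri≈ _ x≡0 _ = ⊥-elim (x≢0 x≡0)
... | tri> _ _ 0<x = ℚP.positive⁻¹ _ {{ℚP.pos*pos⇒pos x {{ℚ.positive 0<x}} x {{ℚ.positive 0<x}}}}

0≤x*x : ∀ x → 0ℚ ≤ x * x
0≤x*x x with x ℚP.≟ 0ℚ
... | yes refl = ℚP.≤-refl
... | no  x≢0  = ℚP.<⇒≤ (x≢0⇒0<x*x x≢0)

0<x∧0≤y⇒0<x+y : ∀ {x y} → 0ℚ < x → 0ℚ ≤ y → 0ℚ < x + y
0<x∧0≤y⇒0<x+y {x} {y} 0<x 0≤y = ℚP.<-≤-trans 0<x (subst (_≤ x + y) (ℚP.+-identityʳ x) (ℚP.+-monoʳ-≤ x 0≤y))

0<x∧0<y⇒0<x*y : ∀ {x y} → 0ℚ < x → 0ℚ < y → 0ℚ < x * y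
0<x∧0<y⇒0<x*y {x} {y} 0<x 0<y = ℚP.positive⁻¹ _ {{ℚP.pos*pos⇒pos x {{ℚ.positive 0<x}} y {{ℚ.positive 0<y}}}}

cube≡0⇒≡0 : ∀ {x} → cube x ≡ 0ℚ → x ≡ 0ℚ
cube≡0⇒≡0 {x} x³≡0 with x ℚP.≟ 0ℚ
... | yes x≡0 = x≡0
... | no  x≢0 = ⊥-elim (x≉0∧y≉0⇒xy≉0 x≢0 (x≉0∧y≉0⇒xy≉0 x≢0 x≢0) x³≡0)

-- x³ - y³ = (x - y)(x² + xy + y²), and 4(x² + xy + y²) = (2x + y)² + 3y² > 0 unless x = y = 0.
cube-injective : ∀ {x y} → cube x ≡ cube y → x ≡ y
cube-injective {x} {y} x³≡y³ with x ℚP.≟ y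
... | yes x≡y = x≡y
... | no  x≢y = ⊥-elim (ℚP.<⇒≢ 0<sum (sym sum≡0))
  where
  factor : ∀ x y → x * (x * x) - y * (y * y) ≡ (x - y) * (x * x + x * y + y * y)
  factor = solve-∀ ℚ-ring
  complete-square : ∀ x y → (x + x + y) * (x + x + y) + (y * y + y * y + y * y)
                            ≡ (x * x + x * y + y * y) * (1ℚ + 1ℚ + 1ℚ + 1ℚ)
  complete-square = solve-∀ ℚ-ring
  q≡0 : x * x + x * y + y * y ≡ 0ℚ
  q≡0 = x≉0∧x*y≈0⇒y≈0 (λ x-y≡0 → x≢y (x∙y⁻¹≈ε⇒x≈y x y x-y≡0))
          (trans (sym (factor x y)) (x≈y⇒x∙y⁻¹≈ε x³≡y³))
  sum≡0 : (x + x + y) * (x + x + y) + (y * y + y * y + y * y) ≡ 0ℚ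
  sum≡0 = trans (complete-square x y) (trans (cong (_* (1ℚ + 1ℚ + 1ℚ + 1ℚ)) q≡0) (ℚP.*-zeroˡ (1ℚ + 1ℚ + 1ℚ + 1ℚ)))
  y≢0 : y ≢ 0ℚ
  y≢0 y≡0 = x≢y (trans (cube≡0⇒≡0 (trans x³≡y³ (cong cube y≡0))) (sym y≡0))
  0<sum : 0ℚ < (x + x + y) * (x + x + y) + (y * y + y * y + y * y)
  0<sum = subst (0ℚ <_) (ℚP.+-comm (y * y + y * y + y * y) ((x + x + y) * (x + x + y)))
    (0<x∧0≤y⇒0<x+y (0<x∧0≤y⇒0<x+y (0<x∧0≤y⇒0<x+y (x≢0⇒0<x*x y≢0) (0≤x*x y)) (0≤x*x y)) (0≤x*x (x + x + y)))

x<y⇒0<y-x : ∀ {x y} → x < y → 0ℚ < y - x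
x<y⇒0<y-x {x} {y} x<y = subst (_< y - x) (ℚP.+-inverseʳ x) (ℚP.+-monoˡ-< (- x) x<y)

0<y-x⇒x<y : ∀ {x y} → 0ℚ < y - x → x < y
0<y-x⇒x<y {x} {y} 0<y-x = subst₂ _<_ (ℚP.+-identityˡ x) (x∙y⁻¹≈ε⇒x≈y _ _ (shift y x)) (ℚP.+-monoˡ-< x 0<y-x)
  where shift : ∀ y x → y - x + x - y ≡ 0ℚ
        shift = solve-∀ ℚ-ring

two<x⇒x<x²-2 : ∀ {x} → two < x → x < x * x - two
two<x⇒x<x²-2 {x} two<x = 0<y-x⇒x<y (subst (0ℚ <_) (sym (factor x)) (0<x∧0<y⇒0<x*y 0<x-2 0<x+1))
  where
  factor : ∀ x → x * x - two - x ≡ (x - two) * (x + 1ℚ)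
  factor = solve-∀ ℚ-ring
  0<x-2 : 0ℚ < x - two
  0<x-2 = x<y⇒0<y-x two<x
  0<x+1 : 0ℚ < x + 1ℚ
  0<x+1 = 0<x∧0≤y⇒0<x+y (ℚP.<-trans (ℚP.positive⁻¹ two) two<x) (ℚP.nonNegative⁻¹ 1ℚ)

-- Along τ (n + 1) = τ n ⁻², the quantity Λ n = τ n² + τ n⁻² obeys Λ (n + 1) = Λ n² - 2, so it
-- increases strictly once it exceeds 2, which it does unless τ 0 = ±1.
module InverseSquareSequence (τ : ℕ → ℚ) (τ-rec : ∀ n → τ (suc n) * (τ n * τ n) ≡ 1ℚ) where

  τ≢0 : ∀ n → τ n ≢ 0ℚ
  τ≢0 n τn≡0 = ℚP.1≢0 (begin
    1ℚ                        ≡⟨ sym (τ-rec n) ⟩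
    τ (suc n) * (τ n * τ n)   ≡⟨ cong (λ t → τ (suc n) * (t * t)) τn≡0 ⟩
    τ (suc n) * (0ℚ * 0ℚ)     ≡⟨ ℚP.*-zeroʳ (τ (suc n)) ⟩
    0ℚ                        ∎)
    where open ≡-Reasoning

  τ-suc-suc : ∀ n → τ (suc (suc n)) ≡ τ n * τ n * (τ n * τ n)
  τ-suc-suc n = *-cancelˡ (x≉0∧y≉0⇒xy≉0 (τ≢0 (suc n)) (τ≢0 (suc n))) (begin
    τ₁ * τ₁ * τ₂                 ≡⟨ ℚP.*-comm (τ₁ * τ₁) τ₂ ⟩
    τ₂ * (τ₁ * τ₁)               ≡⟨ τ-rec (suc n) ⟩
    1ℚ                           ≡⟨ cong₂ _*_ (sym (τ-rec n)) (sym (τ-rec n)) ⟩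
    τ₁ * (τ₀ * τ₀) * (τ₁ * (τ₀ * τ₀))  ≡⟨ regroup τ₀ τ₁ ⟩
    τ₁ * τ₁ * (τ₀ * τ₀ * (τ₀ * τ₀))    ∎)
    where
    open ≡-Reasoning
    τ₀ τ₁ τ₂ : ℚ
    τ₀ = τ n
    τ₁ = τ (suc n)
    τ₂ = τ (suc (suc n))
    regroup : ∀ τ₀ τ₁ → τ₁ * (τ₀ * τ₀) * (τ₁ * (τ₀ * τ₀)) ≡ τ₁ * τ₁ * (τ₀ * τ₀ * (τ₀ * τ₀))
    regroup = solve-∀ ℚ-ring

  Λ : ℕ → ℚ
  Λ n = τ n * τ n + τ (suc n)

  Λ-suc : ∀ n → Λ (suc n) ≡ Λ n * Λ n - two
  Λ-suc n = begin
    τ₁ * τ₁ + τ₂                                          ≡⟨ cong (τ₁ * τ₁ +_) (τ-suc-suc n) ⟩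
    τ₁ * τ₁ + τ₀ * τ₀ * (τ₀ * τ₀)                         ≡⟨ expand τ₀ τ₁ ⟩
    (τ₀ * τ₀ + τ₁) * (τ₀ * τ₀ + τ₁) - two - two * (τ₁ * (τ₀ * τ₀) - 1ℚ)
        ≡⟨ cong (λ r → Λ n * Λ n - two - two * r) (x≈y⇒x∙y⁻¹≈ε (τ-rec n)) ⟩
    Λ n * Λ n - two - two * 0ℚ                            ≡⟨ drop-zero (Λ n * Λ n - two) ⟩
    Λ n * Λ n - two                                       ∎
    where
    open ≡-Reasoning
    τ₀ τ₁ τ₂ : ℚ
    τ₀ = τ n
    τ₁ = τ (suc n)
    τ₂ = τ (suc (suc n))
    expand : ∀ τ₀ τ₁ → τ₁ * τ₁ + τ₀ * τ₀ * (τ₀ * τ₀)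
                       ≡ (τ₀ * τ₀ + τ₁) * (τ₀ * τ₀ + τ₁) - two - two * (τ₁ * (τ₀ * τ₀) - 1ℚ)
    expand = solve-∀ ℚ-ring
    drop-zero : ∀ x → x - two * 0ℚ ≡ x
    drop-zero = solve-∀ ℚ-ring

  Λ-two-square : ∀ n → (τ n - τ n * τ (suc n)) * (τ n - τ n * τ (suc n)) ≡ Λ n - two
  Λ-two-square n = begin
    (τ₀ - τ₀ * τ₁) * (τ₀ - τ₀ * τ₁)                         ≡⟨ expand τ₀ τ₁ ⟩
    Λ n - two + (τ₁ * (τ₀ * τ₀) - 1ℚ) * (τ₁ - two)         ≡⟨ cong (λ r → Λ n - two + r * (τ₁ - two)) (x≈y⇒x∙y⁻¹≈ε (τ-rec n)) ⟩
    Λ n - two + 0ℚ * (τ₁ - two)                             ≡⟨ drop-zero (Λ n - two) (τ₁ - two) ⟩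
    Λ n - two                                               ∎
    where
    open ≡-Reasoning
    τ₀ τ₁ : ℚ
    τ₀ = τ n
    τ₁ = τ (suc n)
    expand : ∀ τ₀ τ₁ → (τ₀ - τ₀ * τ₁) * (τ₀ - τ₀ * τ₁) ≡ τ₀ * τ₀ + τ₁ - two + (τ₁ * (τ₀ * τ₀) - 1ℚ) * (τ₁ - two)
    expand = solve-∀ ℚ-ring
    drop-zero : ∀ x y → x + 0ℚ * y ≡ x
    drop-zero = solve-∀ ℚ-ring

  τ-suc-cong : ∀ {m n} → τ m ≡ τ n → τ (suc m) ≡ τ (suc n)
  τ-suc-cong {m} {n} τm≡τn = *-cancelˡ (x≉0∧y≉0⇒xy≉0 (τ≢0 m) (τ≢0 m)) (begin
    τ m * τ m * τ (suc m)     ≡⟨ ℚP.*-comm (τ m * τ m) (τ (suc m)) ⟩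
    τ (suc m) * (τ m * τ m)   ≡⟨ trans (τ-rec m) (sym (τ-rec n)) ⟩
    τ (suc n) * (τ n * τ n)   ≡⟨ cong (λ t → τ (suc n) * (t * t)) (sym τm≡τn) ⟩
    τ (suc n) * (τ m * τ m)   ≡⟨ ℚP.*-comm (τ (suc n)) (τ m * τ m) ⟩
    τ m * τ m * τ (suc n)     ∎)
    where open ≡-Reasoning

  Λ-increasing : ∀ n → two < Λ n → Λ n < Λ (suc n)
  Λ-increasing n two<Λn = subst (Λ n <_) (sym (Λ-suc n)) (two<x⇒x<x²-2 two<Λn)

  module _ (τ₀≢1 : τ 0 ≢ 1ℚ) (τ₀≢-1 : τ 0 ≢ - 1ℚ) where

    τ₁≢1 : τ 1 ≢ 1ℚ
    τ₁≢1 τ₁≡1 with x*x≡1⇒x≡1∨x≡-1 (trans (sym (ℚP.*-identityˡ (τ 0 * τ 0))) (trans (cong (_* (τ 0 * τ 0)) (sym τ₁≡1)) (τ-rec 0)))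
    ... | inj₁ τ₀≡1  = τ₀≢1 τ₀≡1
    ... | inj₂ τ₀≡-1 = τ₀≢-1 τ₀≡-1

    two<Λ₀ : two < Λ 0
    two<Λ₀ = 0<y-x⇒x<y (subst (0ℚ <_) (Λ-two-square 0) (x≢0⇒0<x*x τ₀-τ₀τ₁≢0))
      where
      factor : ∀ a b → a * (1ℚ - b) ≡ a - a * b
      factor = solve-∀ ℚ-ring
      τ₀-τ₀τ₁≢0 : τ 0 - τ 0 * τ 1 ≢ 0ℚ
      τ₀-τ₀τ₁≢0 τ₀-τ₀τ₁≡0 = τ₁≢1 (sym (x∙y⁻¹≈ε⇒x≈y 1ℚ (τ 1)
        (x≉0∧x*y≈0⇒y≈0 (τ≢0 0) (trans (factor (τ 0) (τ 1)) τ₀-τ₀τ₁≡0))))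

    two<Λ : ∀ n → two < Λ n
    two<Λ zero    = two<Λ₀
    two<Λ (suc n) = ℚP.<-trans (two<Λ n) (Λ-increasing n (two<Λ n))

    Λ-strictMono : ∀ {m n} → m ℕ.< n → Λ m < Λ n
    Λ-strictMono {m} {suc n} (ℕ.s≤s m≤n) with ℕP.m≤n⇒m<n∨m≡n m≤n
    ... | inj₁ m<n  = ℚP.<-trans (Λ-strictMono m<n) (Λ-increasing n (two<Λ n))
    ... | inj₂ refl = Λ-increasing m (two<Λ m)

    Λ-injective : ∀ {m n} → Λ m ≡ Λ n → m ≡ n
    Λ-injective {m} {n} Λm≡Λn with ℕP.<-cmp m n
    ... | tri< m<n _ _ = ⊥-elim (ℚP.<⇒≢ (Λ-strictMono m<n) Λm≡Λn)
    ... | tri≈ _ m≡n _ = m≡n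
    ... | tri> _ _ n<m = ⊥-elim (ℚP.<⇒≢ (Λ-strictMono n<m) (sym Λm≡Λn))

    τ-injective : ∀ {m n} → τ m ≡ τ n → m ≡ n
    τ-injective τm≡τn = Λ-injective (cong₂ _+_ (cong₂ _*_ τm≡τn τm≡τn) (τ-suc-cong τm≡τn))

-- Rational solutions of d x³ = c

coprime-*ʳ : ∀ {m n o} → Coprime m n → Coprime m o → Coprime m (n ℕ.* o)
coprime-*ʳ {n = n} m⊥n m⊥o {d} (d∣m , d∣no) = m⊥o (d∣m , coprime-divisor d⊥n d∣no)
  where d⊥n : Coprime d n
        d⊥n (e∣d , e∣n) = m⊥n (∣-trans e∣d d∣m , e∣n)

numerator⊥denominator : ∀ x → Coprime ∣ ↥ x ∣ (↧ₙ x)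
numerator⊥denominator (ℚ.mkℚ _ _ coprime) = Coprimality.recompute coprime

d*x³≡c⇒ℕ-equation : ∀ {c d x} → d * cube x ≡ c →
  (∣ ↥ d ∣ ℕ.* (∣ ↥ x ∣ ℕ.* (∣ ↥ x ∣ ℕ.* ∣ ↥ x ∣))) ℕ.* ↧ₙ c
  ≡ ∣ ↥ c ∣ ℕ.* (↧ₙ d ℕ.* (↧ₙ x ℕ.* (↧ₙ x ℕ.* ↧ₙ x)))
d*x³≡c⇒ℕ-equation {c@(ℚ.mkℚ _ _ _)} {d@(ℚ.mkℚ _ _ _)} {x@(ℚ.mkℚ _ _ _)} d*x³≡c with unnormalised
  where
  unnormalised : ℚ.toℚᵘ d ℚᵘ.* (ℚ.toℚᵘ x ℚᵘ.* (ℚ.toℚᵘ x ℚᵘ.* ℚ.toℚᵘ x)) ℚᵘ.≃ ℚ.toℚᵘ c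
  unnormalised = ℚᵘP.≃-trans (ℚᵘP.≃-sym (ℚᵘP.≃-trans (ℚP.toℚᵘ-homo-* d (cube x))
    (ℚᵘP.*-congˡ {ℚ.toℚᵘ d} (ℚᵘP.≃-trans (ℚP.toℚᵘ-homo-* x (x * x)) (ℚᵘP.*-congˡ {ℚ.toℚᵘ x} (ℚP.toℚᵘ-homo-* x x))))))
    (ℚP.toℚᵘ-cong d*x³≡c)
... | ℚᵘ.*≡* cross = trans (sym ∣lhs∣) (trans (cong ∣_∣ cross) (∣i*j∣≡∣i∣*∣j∣ (↥ c) (ℤ.+ (↧ₙ d ℕ.* (↧ₙ x ℕ.* (↧ₙ x ℕ.* ↧ₙ x))))))
  where
  open ℤP using (∣i*j∣≡∣i∣*∣j∣)
  ∣lhs∣ : ∣ (↥ d ℤ.* (↥ x ℤ.* (↥ x ℤ.* ↥ x))) ℤ.* ↧ c ∣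
          ≡ (∣ ↥ d ∣ ℕ.* (∣ ↥ x ∣ ℕ.* (∣ ↥ x ∣ ℕ.* ∣ ↥ x ∣))) ℕ.* ↧ₙ c
  ∣lhs∣ = trans (∣i*j∣≡∣i∣*∣j∣ (↥ d ℤ.* (↥ x ℤ.* (↥ x ℤ.* ↥ x))) (↧ c))
    (cong (ℕ._* ↧ₙ c) (trans (∣i*j∣≡∣i∣*∣j∣ (↥ d) (↥ x ℤ.* (↥ x ℤ.* ↥ x)))
      (cong (∣ ↥ d ∣ ℕ.*_) (trans (∣i*j∣≡∣i∣*∣j∣ (↥ x) (↥ x ℤ.* ↥ x))
        (cong (∣ ↥ x ∣ ℕ.*_) (∣i*j∣≡∣i∣*∣j∣ (↥ x) (↥ x)))))))

module CubeEquationBounds {c d x : ℚ} (d*x³≡c : d * cube x ≡ c) where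
  private
    A B C₁ C₂ D₁ D₂ : ℕ
    A = ∣ ↥ x ∣
    B = ↧ₙ x
    C₁ = ∣ ↥ c ∣
    C₂ = ↧ₙ c
    D₁ = ∣ ↥ d ∣
    D₂ = ↧ₙ d
    equation : (D₁ ℕ.* (A ℕ.* (A ℕ.* A))) ℕ.* C₂ ≡ C₁ ℕ.* (D₂ ℕ.* (B ℕ.* (B ℕ.* B)))
    equation = d*x³≡c⇒ℕ-equation {c} {d} {x} d*x³≡c
    A⊥B : Coprime A B
    A⊥B = numerator⊥denominator x

  numerator∣ : A ∣ C₁ ℕ.* D₂
  numerator∣ = coprime-divisor (coprime-*ʳ A⊥B (coprime-*ʳ A⊥B A⊥B))
    (subst (A ∣_) (regroup C₁ D₂ B) (subst (A ∣_) equation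
      (∣m⇒∣m*n C₂ (∣n⇒∣m*n D₁ (m∣m*n (A ℕ.* A))))))
    where regroup : ∀ C₁ D₂ B → C₁ ℕ.* (D₂ ℕ.* (B ℕ.* (B ℕ.* B))) ≡ (B ℕ.* (B ℕ.* B)) ℕ.* (C₁ ℕ.* D₂)
          regroup = ℕSolver.solve-∀

  denominator∣ : B ∣ D₁ ℕ.* C₂
  denominator∣ = coprime-divisor (coprime-*ʳ B⊥A (coprime-*ʳ B⊥A B⊥A))
    (subst (B ∣_) (regroup D₁ A C₂) (subst (B ∣_) (sym equation)
      (∣n⇒∣m*n C₁ (∣n⇒∣m*n D₂ (m∣m*n (B ℕ.* B))))))
    where B⊥A : Coprime B A
          B⊥A = Coprimality.sym A⊥B
          regroup : ∀ D₁ A C₂ → (D₁ ℕ.* (A ℕ.* (A ℕ.* A))) ℕ.* C₂ ≡ (A ℕ.* (A ℕ.* A)) ℕ.* (D₁ ℕ.* C₂)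
          regroup = ℕSolver.solve-∀

-- opaque: unfolding these normalised fractions makes checking the search below very slow
opaque
  candidate : Bool → ℕ → ℕ → ℚ
  candidate true  i j = ℤ.+ i ℚ./ suc j
  candidate false i j = ℤ.- (ℤ.+ i) ℚ./ suc j

opaque
  unfolding candidate

  x≡candidate : ∀ x → ∃ λ sign → x ≡ candidate sign ∣ ↥ x ∣ (ℚ.denominator-1 x)
  x≡candidate x with ℤP.+∣i∣≡i⊎+∣i∣≡-i (↥ x)
  ... | inj₁ +∣↥x∣≡↥x  = true  , trans (sym (ℚP.↥p/↧p≡p x)) (cong (ℚ._/ ↧ₙ x) (sym +∣↥x∣≡↥x))
  ... | inj₂ +∣↥x∣≡-↥x = false , trans (sym (ℚP.↥p/↧p≡p x))
                                   (cong (ℚ._/ ↧ₙ x) (trans (sym (ℤP.neg-involutive (↥ x))) (cong ℤ.-_ (sym +∣↥x∣≡-↥x))))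

SolvedByCandidate : ℚ → ℚ → ℕ → ℕ → Set
SolvedByCandidate c d i j = d * cube (candidate true i j) ≡ c ⊎ d * cube (candidate false i j) ≡ c

solvedByCandidate? : ∀ c d i j → Dec (SolvedByCandidate c d i j)
solvedByCandidate? c d i j = (d * cube (candidate true i j) ℚP.≟ c) ⊎-dec (d * cube (candidate false i j) ℚP.≟ c)

∣↥x∣≡0⇒x≡0 : ∀ x → ∣ ↥ x ∣ ≡ 0 → x ≡ 0ℚ
∣↥x∣≡0⇒x≡0 x ∣↥x∣≡0 = ℚP.↥p≡0⇒p≡0 x (ℤP.∣i∣≡0⇒i≡0 ∣↥x∣≡0)

-- The ranges come from CubeEquationBounds.
CandidateSolution : ℚ → ℚ → Set
CandidateSolution c d =
  ∃ λ (i : Fin (suc (∣ ↥ c ∣ ℕ.* ↧ₙ d))) → ∃ λ (j : Fin (∣ ↥ d ∣ ℕ.* ↧ₙ c)) → SolvedByCandidate c d (toℕ i) (toℕ j)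

candidateSolution? : ∀ c d → Dec (CandidateSolution c d)
candidateSolution? c d = FinP.any? (λ i → FinP.any? (λ j → solvedByCandidate? c d (toℕ i) (toℕ j)))

solution⇒candidateSolution : ∀ {c d x} → c ≢ 0ℚ → d ≢ 0ℚ → d * cube x ≡ c → CandidateSolution c d
solution⇒candidateSolution {c} {d} {x} c≢0 d≢0 d*x³≡c = fromℕ< i< , fromℕ< j< , solves (x≡candidate x)
  where
  open CubeEquationBounds {c} {d} {x} d*x³≡c
  instance
    ∣↥c∣*↧d≢0 : ℕ.NonZero (∣ ↥ c ∣ ℕ.* ↧ₙ d)
    ∣↥c∣*↧d≢0 = ℕP.m*n≢0 ∣ ↥ c ∣ (↧ₙ d) {{ℕ.≢-nonZero (c≢0 ∘ ∣↥x∣≡0⇒x≡0 c)}}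
    ∣↥d∣*↧c≢0 : ℕ.NonZero (∣ ↥ d ∣ ℕ.* ↧ₙ c)
    ∣↥d∣*↧c≢0 = ℕP.m*n≢0 ∣ ↥ d ∣ (↧ₙ c) {{ℕ.≢-nonZero (d≢0 ∘ ∣↥x∣≡0⇒x≡0 d)}}
  i< : ∣ ↥ x ∣ ℕ.< suc (∣ ↥ c ∣ ℕ.* ↧ₙ d)
  i< = ℕ.s≤s (∣⇒≤ numerator∣)
  j< : ℚ.denominator-1 x ℕ.< ∣ ↥ d ∣ ℕ.* ↧ₙ c
  j< = ∣⇒≤ denominator∣
  x≡candidate-at : ∀ sign → x ≡ candidate sign ∣ ↥ x ∣ (ℚ.denominator-1 x) →
                   x ≡ candidate sign (toℕ (fromℕ< i<)) (toℕ (fromℕ< j<))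
  x≡candidate-at sign x≡ = trans x≡ (sym (cong₂ (candidate sign) (FinP.toℕ-fromℕ< i<) (FinP.toℕ-fromℕ< j<)))
  solves : (∃ λ sign → x ≡ candidate sign ∣ ↥ x ∣ (ℚ.denominator-1 x)) →
           SolvedByCandidate c d (toℕ (fromℕ< i<)) (toℕ (fromℕ< j<))
  solves (true  , x≡) = inj₁ (subst (λ y → d * cube y ≡ c) (x≡candidate-at true x≡) d*x³≡c)
  solves (false , x≡) = inj₂ (subst (λ y → d * cube y ≡ c) (x≡candidate-at false x≡) d*x³≡c)

cubeRoot? : ∀ c d → c ≢ 0ℚ → d ≢ 0ℚ → Dec (∃ λ x → d * cube x ≡ c)
cubeRoot? c d c≢0 d≢0 with candidateSolution? c d
... | yes (i , j , inj₁ solution) = yes (candidate true  (toℕ i) (toℕ j) , solution)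
... | yes (i , j , inj₂ solution) = yes (candidate false (toℕ i) (toℕ j) , solution)
... | no  noCandidate = no (λ (x , d*x³≡c) → noCandidate (solution⇒candidateSolution {x = x} c≢0 d≢0 d*x³≡c))

-- Preperiodic points of z ↦ c / (d z²)

-- x /₀ 0 = 0
_/₀_ : ℚ → ℚ → ℚ
x /₀ y with y ℚP.≟ 0ℚ
... | yes _   = 0ℚ
... | no y≢0 = (x ℚ.÷ y) {{ℚ.≢-nonZero y≢0}}

/₀-*-cancel : ∀ x {y} → y ≢ 0ℚ → x /₀ y * y ≡ x
/₀-*-cancel x {y} y≢0 with y ℚP.≟ 0ℚ
... | yes y≡0  = ⊥-elim (y≢0 y≡0)
... | no  y≢0′ = begin
  x * ℚ.1/ y * y      ≡⟨ ℚP.*-assoc x (ℚ.1/ y) y ⟩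
  x * (ℚ.1/ y * y)    ≡⟨ cong (x *_) (ℚP.*-inverseˡ y) ⟩
  x * 1ℚ              ≡⟨ ℚP.*-identityʳ x ⟩
  x                   ∎
  where open ≡-Reasoning
        instance y-nonZero : ℚ.NonZero y
                 y-nonZero = ℚ.≢-nonZero y≢0′

P∞ P₀ : ℚ²
P∞ = (1ℚ , 0ℚ)
P₀ = (0ℚ , 1ℚ)

y≡0⇒∼P∞ : ∀ x {y} → y ≡ 0ℚ → (x , y) ∼ P∞
y≡0⇒∼P∞ x {y} y≡0 = trans (ℚP.*-zeroʳ x) (sym (trans (ℚP.*-identityˡ y) y≡0))

∼P∞⇒y≡0 : ∀ x {y} → (x , y) ∼ P∞ → y ≡ 0ℚ
∼P∞⇒y≡0 x {y} x*0≡1*y = trans (sym (ℚP.*-identityˡ y)) (trans (sym x*0≡1*y) (ℚP.*-zeroʳ x))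

x≡0⇒∼P₀ : ∀ {x} y → x ≡ 0ℚ → (x , y) ∼ P₀
x≡0⇒∼P₀ {x} y x≡0 = trans (ℚP.*-identityʳ x) (trans x≡0 (sym (ℚP.*-zeroˡ y)))

∼P₀⇒x≡0 : ∀ {x} y → (x , y) ∼ P₀ → x ≡ 0ℚ
∼P₀⇒x≡0 {x} y x*1≡0*y = trans (sym (ℚP.*-identityʳ x)) (trans x*1≡0*y (ℚP.*-zeroˡ y))

PreperiodicClassification : QuadMap → ℚ² → ℚ² → Set
PreperiodicClassification φ P Q =
  ((∀ R → NonzeroQ R → ¬ Fixed φ R) ×
   (∀ R → NonzeroQ R → Preperiodic φ R → (R ∼ P) ⊎ (R ∼ Q)))
  ⊎
  (∃ λ F → NonzeroQ F × Fixed φ F ×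
    (∀ R → NonzeroQ R → Fixed φ R → R ∼ F) ×
    (∃ λ T → NonzeroQ T × ¬ Fixed φ T × (applyQ φ T ∼ F) ×
      (∀ R → NonzeroQ R → Preperiodic φ R →
        (R ∼ P) ⊎ (R ∼ Q) ⊎ (R ∼ F) ⊎ (R ∼ T))))

ψ[_,_] : ℚ → ℚ → QuadMap
ψ[ c , d ] = quad 0ℚ 0ℚ c d 0ℚ 0ℚ

module InverseSquareNormalForm (c d : ℚ) (c≢0 : c ≢ 0ℚ) (d≢0 : d ≢ 0ℚ) where

  ψ : QuadMap
  ψ = ψ[ c , d ]

  ψ-apply : ∀ s t → applyQ ψ (s , t) ≡ (c * (t * t) , d * (s * s))
  ψ-apply s t = cong₂ _,_ (first c s t) (second d s t)
    where first : ∀ c s t → 0ℚ * (s * s) + 0ℚ * (s * t) + c * (t * t) ≡ c * (t * t)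
          first = solve-∀ ℚ-ring
          second : ∀ d s t → d * (s * s) + 0ℚ * (s * t) + 0ℚ * (t * t) ≡ d * (s * s)
          second = solve-∀ ℚ-ring

  private
    fixed-lhs : ∀ s t → proj₁ (applyQ ψ (s , t)) * t ≡ c * cube t
    fixed-lhs s t = identity c s t
      where identity : ∀ c s t → (0ℚ * (s * s) + 0ℚ * (s * t) + c * (t * t)) * t ≡ c * (t * (t * t))
            identity = solve-∀ ℚ-ring
    fixed-rhs : ∀ s t → s * proj₂ (applyQ ψ (s , t)) ≡ d * cube s
    fixed-rhs s t = identity d s t
      where identity : ∀ d s t → s * (d * (s * s) + 0ℚ * (s * t) + 0ℚ * (t * t)) ≡ d * (s * (s * s))
            identity = solve-∀ ℚ-ring

  Fixed-ψ⇒ : ∀ s t → Fixed ψ (s , t) → d * cube s ≡ c * cube t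
  Fixed-ψ⇒ s t fixed = trans (sym (fixed-rhs s t)) (trans (sym fixed) (fixed-lhs s t))

  ⇒Fixed-ψ : ∀ s t → d * cube s ≡ c * cube t → Fixed ψ (s , t)
  ⇒Fixed-ψ s t d*s³≡c*t³ = trans (fixed-lhs s t) (trans (sym d*s³≡c*t³) (sym (fixed-rhs s t)))

  c*t³≢0 : ∀ {t} → t ≢ 0ℚ → c * cube t ≢ 0ℚ
  c*t³≢0 t≢0 = x≉0∧y≉0⇒xy≉0 c≢0 (t≢0 ∘ cube≡0⇒≡0)

  Fixed-ψ⇒t≢0 : ∀ {s t} → NonzeroQ (s , t) → Fixed ψ (s , t) → t ≢ 0ℚ
  Fixed-ψ⇒t≢0 {s} {t} st≢0 fixed t≡0 = st≢0 (s≡0 , t≡0)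
    where s≡0 : s ≡ 0ℚ
          s≡0 = cube≡0⇒≡0 (x≉0∧x*y≈0⇒y≈0 d≢0 (trans (Fixed-ψ⇒ s t fixed) (trans (cong (λ t → c * cube t) t≡0) (ℚP.*-zeroʳ c))))

  Fixed-ψ⇒cube-root : ∀ {s t} → NonzeroQ (s , t) → Fixed ψ (s , t) → ∃ λ x → d * cube x ≡ c
  Fixed-ψ⇒cube-root {s} {t} st≢0 fixed = s /₀ t , *-cancelˡ (t≢0 ∘ cube≡0⇒≡0) (begin
    cube t * (d * cube (s /₀ t))   ≡⟨ regroup d (s /₀ t) t ⟩
    d * cube (s /₀ t * t)          ≡⟨ cong (λ s → d * cube s) (/₀-*-cancel s t≢0) ⟩
    d * cube s                     ≡⟨ Fixed-ψ⇒ s t fixed ⟩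
    c * cube t                     ≡⟨ ℚP.*-comm c (cube t) ⟩
    cube t * c                     ∎)
    where
    open ≡-Reasoning
    t≢0 : t ≢ 0ℚ
    t≢0 = Fixed-ψ⇒t≢0 st≢0 fixed
    regroup : ∀ d x t → t * (t * t) * (d * (x * (x * x))) ≡ d * ((x * t) * ((x * t) * (x * t)))
    regroup = solve-∀ ℚ-ring

  Fixed-ψ⇒∼ : ∀ s t x → NonzeroQ (s , t) → Fixed ψ (s , t) → d * cube x ≡ c → (s , t) ∼ (x , 1ℚ)
  Fixed-ψ⇒∼ s t x st≢0 fixed d*x³≡c = trans (ℚP.*-identityʳ s) (cube-injective (*-cancelˡ d≢0 (begin
    d * cube s             ≡⟨ Fixed-ψ⇒ s t fixed ⟩
    c * cube t             ≡⟨ cong (_* cube t) (sym d*x³≡c) ⟩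
    d * cube x * cube t    ≡⟨ regroup d x t ⟩
    d * cube (x * t)       ∎)))
    where
    open ≡-Reasoning
    regroup : ∀ d x t → d * (x * (x * x)) * (t * (t * t)) ≡ d * ((x * t) * ((x * t) * (x * t)))
    regroup = solve-∀ ℚ-ring

  -- ψ acts on ratios as r ↦ r⁻², which confines preperiodic points to ratio ±1.
  ratio : ℚ² → ℚ
  ratio (s , t) = (d * cube s) /₀ (c * cube t)

  ratio-spec : ∀ s {t} → t ≢ 0ℚ → ratio (s , t) * (c * cube t) ≡ d * cube s
  ratio-spec s t≢0 = /₀-*-cancel (d * cube s) (c*t³≢0 t≢0)

  ratio-∼ : ∀ R S → proj₂ R ≢ 0ℚ → proj₂ S ≢ 0ℚ → R ∼ S → ratio R ≡ ratio S
  ratio-∼ (s , t) (s′ , t′) t≢0 t′≢0 st′≡s′t = *-cancelˡ (x≉0∧y≉0⇒xy≉0 (c*t³≢0 t≢0) (t′≢0 ∘ cube≡0⇒≡0)) (begin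
    c * cube t * cube t′ * r                ≡⟨ regroup c t t′ r ⟩
    r * (c * cube t) * cube t′              ≡⟨ cong (_* cube t′) (ratio-spec s t≢0) ⟩
    d * cube s * cube t′                    ≡⟨ cube-* d s t′ ⟩
    d * cube (s * t′)                       ≡⟨ cong (λ z → d * cube z) st′≡s′t ⟩
    d * cube (s′ * t)                       ≡⟨ sym (cube-* d s′ t) ⟩
    d * cube s′ * cube t                    ≡⟨ cong (_* cube t) (sym (ratio-spec s′ t′≢0)) ⟩
    r′ * (c * cube t′) * cube t             ≡⟨ regroup′ c t t′ r′ ⟩
    c * cube t * cube t′ * r′               ∎)
    where
    open ≡-Reasoning
    r r′ : ℚ
    r = ratio (s , t)
    r′ = ratio (s′ , t′)
    regroup : ∀ c t t′ r → c * (t * (t * t)) * (t′ * (t′ * t′)) * r ≡ r * (c * (t * (t * t))) * (t′ * (t′ * t′))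
    regroup = solve-∀ ℚ-ring
    regroup′ : ∀ c t t′ r → r * (c * (t′ * (t′ * t′))) * (t * (t * t)) ≡ c * (t * (t * t)) * (t′ * (t′ * t′)) * r
    regroup′ = solve-∀ ℚ-ring
    cube-* : ∀ d x y → d * (x * (x * x)) * (y * (y * y)) ≡ d * ((x * y) * ((x * y) * (x * y)))
    cube-* = solve-∀ ℚ-ring

  Coords≢0 : ℚ² → Set
  Coords≢0 (s , t) = s ≢ 0ℚ × t ≢ 0ℚ

  ψ-coords≢0 : ∀ {R} → Coords≢0 R → Coords≢0 (applyQ ψ R)
  ψ-coords≢0 {s , t} (s≢0 , t≢0) = subst Coords≢0 (sym (ψ-apply s t))
    (x≉0∧y≉0⇒xy≉0 c≢0 (x≉0∧y≉0⇒xy≉0 t≢0 t≢0) , x≉0∧y≉0⇒xy≉0 d≢0 (x≉0∧y≉0⇒xy≉0 s≢0 s≢0))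

  iterQ-coords≢0 : ∀ {R} → Coords≢0 R → ∀ n → Coords≢0 (iterQ ψ n R)
  iterQ-coords≢0 R≢0 zero    = R≢0
  iterQ-coords≢0 R≢0 (suc n) = ψ-coords≢0 (iterQ-coords≢0 R≢0 n)

  ratio-ψ : ∀ R → Coords≢0 R → ratio (applyQ ψ R) * (ratio R * ratio R) ≡ 1ℚ
  ratio-ψ (s , t) (s≢0 , t≢0) = sym (*-cancelˡ K≢0 (begin
    K * 1ℚ                                        ≡⟨ ℚP.*-identityʳ K ⟩
    K                                             ≡⟨ rearrange c d s t ⟩
    d * cube (c * (t * t)) * (d * cube s * (d * cube s))
        ≡⟨ cong₂ (λ a b → a * (b * b)) (sym (ratio-spec (c * (t * t)) ds²≢0)) (sym (ratio-spec s t≢0)) ⟩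
    r′ * (c * cube (d * (s * s))) * (r * (c * cube t) * (r * (c * cube t)))   ≡⟨ regroup (c * cube (d * (s * s))) (c * cube t) r r′ ⟩
    K * (r′ * (r * r))                            ≡⟨ cong (λ R → K * (ratio R * (r * r))) (sym (ψ-apply s t)) ⟩
    K * (ratio (applyQ ψ (s , t)) * (r * r))      ∎))
    where
    open ≡-Reasoning
    r r′ K : ℚ
    r = ratio (s , t)
    r′ = ratio (c * (t * t) , d * (s * s))
    K = c * cube (d * (s * s)) * (c * cube t * (c * cube t))
    ds²≢0 : d * (s * s) ≢ 0ℚ
    ds²≢0 = x≉0∧y≉0⇒xy≉0 d≢0 (x≉0∧y≉0⇒xy≉0 s≢0 s≢0)
    K≢0 : K ≢ 0ℚ
    K≢0 = x≉0∧y≉0⇒xy≉0 (c*t³≢0 ds²≢0) (x≉0∧y≉0⇒xy≉0 (c*t³≢0 t≢0) (c*t³≢0 t≢0))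
    rearrange : ∀ c d s t → c * ((d * (s * s)) * ((d * (s * s)) * (d * (s * s)))) * (c * (t * (t * t)) * (c * (t * (t * t))))
                          ≡ d * ((c * (t * t)) * ((c * (t * t)) * (c * (t * t)))) * (d * (s * (s * s)) * (d * (s * (s * s))))
    rearrange = solve-∀ ℚ-ring
    regroup : ∀ a b r r′ → r′ * a * (r * b * (r * b)) ≡ a * (b * b) * (r′ * (r * r))
    regroup = solve-∀ ℚ-ring

  ratio≢±1⇒¬preperiodic : ∀ R → Coords≢0 R → ratio R ≢ 1ℚ → ratio R ≢ - 1ℚ → ¬ Preperiodic ψ R
  ratio≢±1⇒¬preperiodic R R≢0 r≢1 r≢-1 (m , n , m≢n , Rₘ∼Rₙ) = m≢n (τ-injective r≢1 r≢-1 τₘ≡τₙ)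
    where
    open InverseSquareSequence (λ n → ratio (iterQ ψ n R)) (λ n → ratio-ψ (iterQ ψ n R) (iterQ-coords≢0 R≢0 n))
    τₘ≡τₙ : ratio (iterQ ψ m R) ≡ ratio (iterQ ψ n R)
    τₘ≡τₙ = ratio-∼ (iterQ ψ m R) (iterQ ψ n R) (proj₂ (iterQ-coords≢0 R≢0 m)) (proj₂ (iterQ-coords≢0 R≢0 n)) Rₘ∼Rₙ

  data PreperiodicCase (R : ℚ²) : Set where
    is-P∞             : R ∼ P∞ → PreperiodicCase R
    is-P₀             : R ∼ P₀ → PreperiodicCase R
    is-fixed          : Fixed ψ R → PreperiodicCase R
    negation-is-fixed : Fixed ψ (- proj₁ R , proj₂ R) → PreperiodicCase R

  preperiodic-case : ∀ R → NonzeroQ R → Preperiodic ψ R → PreperiodicCase R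
  preperiodic-case (s , t) st≢0 preperiodic with t ℚP.≟ 0ℚ | s ℚP.≟ 0ℚ
  ... | yes t≡0 | _       = is-P∞ (y≡0⇒∼P∞ s t≡0)
  ... | no  _   | yes s≡0 = is-P₀ (x≡0⇒∼P₀ t s≡0)
  ... | no  t≢0 | no  s≢0 with ratio (s , t) ℚP.≟ 1ℚ | ratio (s , t) ℚP.≟ - 1ℚ
  ...   | yes r≡1 | _        = is-fixed (⇒Fixed-ψ s t (begin
    d * cube s                   ≡⟨ sym (ratio-spec s t≢0) ⟩
    ratio (s , t) * (c * cube t) ≡⟨ cong (_* (c * cube t)) r≡1 ⟩
    1ℚ * (c * cube t)            ≡⟨ ℚP.*-identityˡ (c * cube t) ⟩
    c * cube t                   ∎))
    where open ≡-Reasoning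
  ...   | no _    | yes r≡-1 = negation-is-fixed (⇒Fixed-ψ (- s) t (begin
    d * cube (- s)                  ≡⟨ neg-cube d s ⟩
    - (d * cube s)                  ≡⟨ cong -_ (sym (ratio-spec s t≢0)) ⟩
    - (ratio (s , t) * (c * cube t)) ≡⟨ cong (λ r → - (r * (c * cube t))) r≡-1 ⟩
    - (- 1ℚ * (c * cube t))         ≡⟨ neg-neg-one (c * cube t) ⟩
    c * cube t                      ∎))
    where
    open ≡-Reasoning
    neg-cube : ∀ d s → d * ((- s) * ((- s) * (- s))) ≡ - (d * (s * (s * s)))
    neg-cube = solve-∀ ℚ-ring
    neg-neg-one : ∀ x → - (- 1ℚ * x) ≡ x
    neg-neg-one = solve-∀ ℚ-ring
  ...   | no r≢1  | no r≢-1  = ⊥-elim (ratio≢±1⇒¬preperiodic (s , t) (s≢0 , t≢0) r≢1 r≢-1 preperiodic)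

  negation-nonzero : ∀ {s t} → NonzeroQ (s , t) → NonzeroQ (- s , t)
  negation-nonzero st≢0 (-s≡0 , t≡0) = st≢0 (ℚP.neg-injective -s≡0 , t≡0)

  module WithoutCubeRoot (no-root : ¬ ∃ λ x → d * cube x ≡ c) where

    no-fixed-point : ∀ R → NonzeroQ R → ¬ Fixed ψ R
    no-fixed-point (s , t) st≢0 fixed = no-root (Fixed-ψ⇒cube-root st≢0 fixed)

    preperiodic⇒cycle : ∀ R → NonzeroQ R → Preperiodic ψ R → R ∼ P∞ ⊎ R ∼ P₀
    preperiodic⇒cycle R R≢0 preperiodic with preperiodic-case R R≢0 preperiodic
    ... | is-P∞ R∼P∞      = inj₁ R∼P∞
    ... | is-P₀ R∼P₀      = inj₂ R∼P₀
    ... | is-fixed R-fixed   = ⊥-elim (no-fixed-point R R≢0 R-fixed)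
    ... | negation-is-fixed -R-fixed = ⊥-elim (no-fixed-point _ (negation-nonzero R≢0) -R-fixed)

  module WithCubeRoot (x : ℚ) (d*x³≡c : d * cube x ≡ c) where

    F T : ℚ²
    F = (x , 1ℚ)
    T = (- x , 1ℚ)

    F≢0 : NonzeroQ F
    F≢0 (_ , 1≡0) = ℚP.1≢0 1≡0

    T≢0 : NonzeroQ T
    T≢0 (_ , 1≡0) = ℚP.1≢0 1≡0

    F-fixed : Fixed ψ F
    F-fixed = ⇒Fixed-ψ x 1ℚ (trans d*x³≡c (sym (c*1³≡c c)))
      where c*1³≡c : ∀ c → c * (1ℚ * (1ℚ * 1ℚ)) ≡ c
            c*1³≡c = solve-∀ ℚ-ring

    fixed⇒∼F : ∀ R → NonzeroQ R → Fixed ψ R → R ∼ F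
    fixed⇒∼F (s , t) st≢0 fixed = Fixed-ψ⇒∼ s t x st≢0 fixed d*x³≡c

    ψT∼F : applyQ ψ T ∼ F
    ψT∼F = subst (_∼ F) (trans (ψ-apply x 1ℚ) (trans (cong (λ y → (c * (1ℚ * 1ℚ) , d * y)) (x²≡[-x]² x)) (sym (ψ-apply (- x) 1ℚ)))) F-fixed
      where x²≡[-x]² : ∀ x → x * x ≡ (- x) * (- x)
            x²≡[-x]² = solve-∀ ℚ-ring

    T-not-fixed : ¬ Fixed ψ T
    T-not-fixed T-fixed = c≢0 (begin
      c                ≡⟨ sym d*x³≡c ⟩
      d * cube x       ≡⟨ cong (λ y → d * cube y) x≡0 ⟩
      d * cube 0ℚ      ≡⟨ ℚP.*-zeroʳ d ⟩
      0ℚ               ∎)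
      where
      open ≡-Reasoning
      -x≡x : - x ≡ x
      -x≡x = trans (sym (ℚP.*-identityʳ (- x))) (trans (fixed⇒∼F T T≢0 T-fixed) (ℚP.*-identityʳ x))
      double : ∀ x → two * x ≡ x - - x
      double = solve-∀ ℚ-ring
      x≡0 : x ≡ 0ℚ
      x≡0 = x≉0∧x*y≈0⇒y≈0 {two} (λ ()) (trans (double x) (x≈y⇒x∙y⁻¹≈ε (sym -x≡x)))

    preperiodic⇒cycle-or-F-or-T : ∀ R → NonzeroQ R → Preperiodic ψ R → R ∼ P∞ ⊎ R ∼ P₀ ⊎ R ∼ F ⊎ R ∼ T
    preperiodic⇒cycle-or-F-or-T R R≢0 preperiodic with preperiodic-case R R≢0 preperiodic
    ... | is-P∞ R∼P∞      = inj₁ R∼P∞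
    ... | is-P₀ R∼P₀      = inj₂ (inj₁ R∼P₀)
    ... | is-fixed R-fixed   = inj₂ (inj₂ (inj₁ (fixed⇒∼F R R≢0 R-fixed)))
    ... | negation-is-fixed -R-fixed = inj₂ (inj₂ (inj₂ (negate R (fixed⇒∼F _ (negation-nonzero R≢0) -R-fixed))))
      where
      negate : ∀ R → (- proj₁ R , proj₂ R) ∼ F → R ∼ T
      negate (s , t) -s*1≡x*t = trans (neg-neg s) (trans (cong -_ -s*1≡x*t) (ℚP.neg-distribˡ-* x t))
        where neg-neg : ∀ s → s * 1ℚ ≡ - ((- s) * 1ℚ)
              neg-neg = solve-∀ ℚ-ring

  normal-form-classification : PreperiodicClassification ψ P∞ P₀
  normal-form-classification with cubeRoot? c d c≢0 d≢0
  ... | no no-root = inj₁ (no-fixed-point , preperiodic⇒cycle)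
    where open WithoutCubeRoot no-root
  ... | yes (x , d*x³≡c) =
    inj₂ (F , F≢0 , F-fixed , fixed⇒∼F , T , T≢0 , T-not-fixed , ψT∼F , preperiodic⇒cycle-or-F-or-T)
    where open WithCubeRoot x d*x³≡c

-- Reduction to the normal form

applyQ-P∞ : ∀ a b c d e f → applyQ (quad a b c d e f) P∞ ≡ (a , d)
applyQ-P∞ a b c d e f = cong₂ _,_ (value a b c) (value d e f)
  where value : ∀ a b c → a * (1ℚ * 1ℚ) + b * (1ℚ * 0ℚ) + c * (0ℚ * 0ℚ) ≡ a
        value = solve-∀ ℚ-ring

applyQ-P₀ : ∀ a b c d e f → applyQ (quad a b c d e f) P₀ ≡ (c , f)
applyQ-P₀ a b c d e f = cong₂ _,_ (value a b c) (value d e f)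
  where value : ∀ a b c → a * (0ℚ * 0ℚ) + b * (0ℚ * 1ℚ) + c * (1ℚ * 1ℚ) ≡ c
        value = solve-∀ ℚ-ring

swap-normal-form : ∀ φ → (∀ S → NonzeroQ S → NonzeroQ (applyQ φ S)) →
  applyQ φ P∞ ∼ P₀ → applyQ φ P₀ ∼ P∞ →
  (∀ S → NonzeroQ S → applyQ φ S ∼ P₀ → S ∼ P∞) →
  (∀ S → NonzeroQ S → applyQ φ S ∼ P∞ → S ∼ P₀) →
  ∃ λ c → ∃ λ d → c ≢ 0ℚ × d ≢ 0ℚ × φ ≡ ψ[ c , d ]
swap-normal-form (quad a b c d e f) φ≢0 φP∞∼P₀ φP₀∼P∞ only-P∞↦P₀ only-P₀↦P∞ =
  c , d , c≢0 , d≢0 , trans (cong₂ (λ a f → quad a b c d e f) a≡0 f≡0) (cong₂ (λ b e → quad 0ℚ b c d e 0ℚ) b≡0 e≡0)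
  where
  a≡0 : a ≡ 0ℚ
  a≡0 = ∼P₀⇒x≡0 d (subst (_∼ P₀) (applyQ-P∞ a b c d e f) φP∞∼P₀)
  f≡0 : f ≡ 0ℚ
  f≡0 = ∼P∞⇒y≡0 c (subst (_∼ P∞) (applyQ-P₀ a b c d e f) φP₀∼P∞)
  d≢0 : d ≢ 0ℚ
  d≢0 d≡0 = φ≢0 P∞ (λ (1≡0 , _) → ℚP.1≢0 1≡0) (subst (λ R → proj₁ R ≡ 0ℚ × proj₂ R ≡ 0ℚ) (sym (applyQ-P∞ a b c d e f)) (a≡0 , d≡0))
  c≢0 : c ≢ 0ℚ
  c≢0 c≡0 = φ≢0 P₀ (λ (_ , 1≡0) → ℚP.1≢0 1≡0) (subst (λ R → proj₁ R ≡ 0ℚ × proj₂ R ≡ 0ℚ) (sym (applyQ-P₀ a b c d e f)) (c≡0 , f≡0))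
  -- [c : -b] is a zero of the first form c Y² + b X Y
  b≡0 : b ≡ 0ℚ
  b≡0 = ℚP.neg-injective (∼P∞⇒y≡0 c (only-P∞↦P₀ (c , - b) (λ (c≡0 , _) → c≢0 c≡0)
          (x≡0⇒∼P₀ (d * (c * c) + e * (c * (- b)) + f * ((- b) * (- b))) (trans (first-form a b c) (trans (cong (_* (c * c)) a≡0) (ℚP.*-zeroˡ (c * c)))))))
    where first-form : ∀ a b c → a * (c * c) + b * (c * (- b)) + c * ((- b) * (- b)) ≡ a * (c * c)
          first-form = solve-∀ ℚ-ring
  -- [e : -d] is a zero of the second form d X² + e X Y
  e≡0 : e ≡ 0ℚ
  e≡0 = ∼P₀⇒x≡0 (- d) (only-P₀↦P∞ (e , - d) (λ (_ , -d≡0) → d≢0 (ℚP.neg-injective -d≡0))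
          (y≡0⇒∼P∞ (a * (e * e) + b * (e * (- d)) + c * ((- d) * (- d))) (trans (second-form d e f) (trans (cong (_* (d * d)) f≡0) (ℚP.*-zeroˡ (d * d))))))
    where second-form : ∀ d e f → d * (e * e) + e * (e * (- d)) + f * ((- d) * (- d)) ≡ f * (d * d)
          second-form = solve-∀ ℚ-ring

infixr 25 _·_

_·_ : ℚ → ℚ² → ℚ²
λ′ · (x , y) = (λ′ * x , λ′ * y)

1·v≡v : ∀ v → 1ℚ · v ≡ v
1·v≡v (x , y) = cong₂ _,_ (ℚP.*-identityˡ x) (ℚP.*-identityˡ y)

·-assoc : ∀ λ′ μ v → λ′ · μ · v ≡ (λ′ * μ) · v
·-assoc λ′ μ (x , y) = cong₂ _,_ (sym (ℚP.*-assoc λ′ μ x)) (sym (ℚP.*-assoc λ′ μ y))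

·-∼ : ∀ λ′ μ v w → v ∼ w → λ′ · v ∼ μ · w
·-∼ λ′ μ (x , y) (x′ , y′) xy′≡x′y = begin
  λ′ * x * (μ * y′)   ≡⟨ regroup λ′ μ x y′ ⟩
  λ′ * μ * (x * y′)   ≡⟨ cong (λ′ * μ *_) xy′≡x′y ⟩
  λ′ * μ * (x′ * y)   ≡⟨ regroup′ λ′ μ x′ y ⟩
  μ * x′ * (λ′ * y)   ∎
  where
  open ≡-Reasoning
  regroup : ∀ λ′ μ x y′ → λ′ * x * (μ * y′) ≡ λ′ * μ * (x * y′)
  regroup = solve-∀ ℚ-ring
  regroup′ : ∀ λ′ μ x′ y → λ′ * μ * (x′ * y) ≡ μ * x′ * (λ′ * y)
  regroup′ = solve-∀ ℚ-ring

·-reflects-∼ : ∀ {λ′ μ} v w → λ′ ≢ 0ℚ → μ ≢ 0ℚ → λ′ · v ∼ μ · w → v ∼ w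
·-reflects-∼ {λ′} {μ} (x , y) (x′ , y′) λ≢0 μ≢0 λxμy′≡μx′λy = *-cancelˡ (x≉0∧y≉0⇒xy≉0 λ≢0 μ≢0) (begin
  λ′ * μ * (x * y′)   ≡⟨ regroup λ′ μ x y′ ⟩
  λ′ * x * (μ * y′)   ≡⟨ λxμy′≡μx′λy ⟩
  μ * x′ * (λ′ * y)   ≡⟨ regroup′ λ′ μ x′ y ⟩
  λ′ * μ * (x′ * y)   ∎)
  where
  open ≡-Reasoning
  regroup : ∀ λ′ μ x y′ → λ′ * μ * (x * y′) ≡ λ′ * x * (μ * y′)
  regroup = solve-∀ ℚ-ring
  regroup′ : ∀ λ′ μ x′ y → μ * x′ * (λ′ * y) ≡ λ′ * μ * (x′ * y)
  regroup′ = solve-∀ ℚ-ring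

applyQ-· : ∀ φ λ′ v → applyQ φ (λ′ · v) ≡ (λ′ * λ′) · applyQ φ v
applyQ-· (quad a b c d e f) λ′ (x , y) = cong₂ _,_ (homogeneous a b c λ′ x y) (homogeneous d e f λ′ x y)
  where homogeneous : ∀ a b c λ′ x y → a * ((λ′ * x) * (λ′ * x)) + b * ((λ′ * x) * (λ′ * y)) + c * ((λ′ * y) * (λ′ * y))
                                       ≡ (λ′ * λ′) * (a * (x * x) + b * (x * y) + c * (y * y))
        homogeneous = solve-∀ ℚ-ring

-- Coordinates (s : t) ↦ s P + t Q, in which the 2-cycle {P, Q} becomes {∞, 0}.
module ChangeOfCoordinates (φ : QuadMap) (p₁ p₂ q₁ q₂ : ℚ) (P≁Q : ¬ (p₁ , p₂) ∼ (q₁ , q₂)) where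

  P Q : ℚ²
  P = (p₁ , p₂)
  Q = (q₁ , q₂)

  D : ℚ
  D = p₁ * q₂ - q₁ * p₂

  D≢0 : D ≢ 0ℚ
  D≢0 D≡0 = P≁Q (x∙y⁻¹≈ε⇒x≈y (p₁ * q₂) (q₁ * p₂) D≡0)

  N : ℚ² → ℚ²
  N (s , t) = (s * p₁ + t * q₁ , s * p₂ + t * q₂)

  adj : ℚ² → ℚ²
  adj (x , y) = (q₂ * x - q₁ * y , p₁ * y - p₂ * x)

  N-P∞ : N P∞ ≡ P
  N-P∞ = cong₂ _,_ (value p₁ q₁) (value p₂ q₂)
    where value : ∀ p q → 1ℚ * p + 0ℚ * q ≡ p
          value = solve-∀ ℚ-ring

  N-P₀ : N P₀ ≡ Q
  N-P₀ = cong₂ _,_ (value p₁ q₁) (value p₂ q₂)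
    where value : ∀ p q → 0ℚ * p + 1ℚ * q ≡ q
          value = solve-∀ ℚ-ring

  adj∘N : ∀ S → adj (N S) ≡ D · S
  adj∘N (s , t) = cong₂ _,_ (first p₁ p₂ q₁ q₂ s t) (second p₁ p₂ q₁ q₂ s t)
    where first : ∀ p₁ p₂ q₁ q₂ s t → q₂ * (s * p₁ + t * q₁) - q₁ * (s * p₂ + t * q₂) ≡ (p₁ * q₂ - q₁ * p₂) * s
          first = solve-∀ ℚ-ring
          second : ∀ p₁ p₂ q₁ q₂ s t → p₁ * (s * p₂ + t * q₂) - p₂ * (s * p₁ + t * q₁) ≡ (p₁ * q₂ - q₁ * p₂) * t
          second = solve-∀ ℚ-ring

  N∘adj : ∀ R → N (adj R) ≡ D · R
  N∘adj (x , y) = cong₂ _,_ (first p₁ p₂ q₁ q₂ x y) (second p₁ p₂ q₁ q₂ x y)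
    where first : ∀ p₁ p₂ q₁ q₂ x y → (q₂ * x - q₁ * y) * p₁ + (p₁ * y - p₂ * x) * q₁ ≡ (p₁ * q₂ - q₁ * p₂) * x
          first = solve-∀ ℚ-ring
          second : ∀ p₁ p₂ q₁ q₂ x y → (q₂ * x - q₁ * y) * p₂ + (p₁ * y - p₂ * x) * q₂ ≡ (p₁ * q₂ - q₁ * p₂) * y
          second = solve-∀ ℚ-ring

  adj-· : ∀ λ′ R → adj (λ′ · R) ≡ λ′ · adj R
  adj-· λ′ (x , y) = cong₂ _,_ (linear q₂ q₁ λ′ x y) (linear p₁ p₂ λ′ y x)
    where linear : ∀ a b λ′ x y → a * (λ′ * x) - b * (λ′ * y) ≡ λ′ * (a * x - b * y)
          linear = solve-∀ ℚ-ring

  private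
    det-adj : ∀ x y x′ y′ → (q₂ * x - q₁ * y) * (p₁ * y′ - p₂ * x′) - (q₂ * x′ - q₁ * y′) * (p₁ * y - p₂ * x)
                            ≡ D * (x * y′ - x′ * y)
    det-adj x y x′ y′ = identity p₁ p₂ q₁ q₂ x y x′ y′
      where identity : ∀ p₁ p₂ q₁ q₂ x y x′ y′ →
                       (q₂ * x - q₁ * y) * (p₁ * y′ - p₂ * x′) - (q₂ * x′ - q₁ * y′) * (p₁ * y - p₂ * x)
                       ≡ (p₁ * q₂ - q₁ * p₂) * (x * y′ - x′ * y)
            identity = solve-∀ ℚ-ring

  adj-∼ : ∀ {v w} → v ∼ w → adj v ∼ adj w
  adj-∼ {x , y} {x′ , y′} xy′≡x′y = x∙y⁻¹≈ε⇒x≈y _ _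
    (trans (det-adj x y x′ y′) (trans (cong (D *_) (x≈y⇒x∙y⁻¹≈ε xy′≡x′y)) (ℚP.*-zeroʳ D)))

  adj-reflects-∼ : ∀ {v w} → adj v ∼ adj w → v ∼ w
  adj-reflects-∼ {x , y} {x′ , y′} adj∼adj = x∙y⁻¹≈ε⇒x≈y _ _
    (x≉0∧x*y≈0⇒y≈0 D≢0 (trans (sym (det-adj x y x′ y′)) (x≈y⇒x∙y⁻¹≈ε adj∼adj)))

  ·-reflects-origin : ∀ {λ′} R → λ′ ≢ 0ℚ → λ′ · R ≡ (0ℚ , 0ℚ) → proj₁ R ≡ 0ℚ × proj₂ R ≡ 0ℚ
  ·-reflects-origin (x , y) λ≢0 λR≡0 = x≉0∧x*y≈0⇒y≈0 λ≢0 (cong proj₁ λR≡0) , x≉0∧x*y≈0⇒y≈0 λ≢0 (cong proj₂ λR≡0)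

  adj-nonzero : ∀ {R} → NonzeroQ R → NonzeroQ (adj R)
  adj-nonzero {R} R≢0 (adj₁≡0 , adj₂≡0) = R≢0 (·-reflects-origin R D≢0 (begin
    D · R             ≡⟨ sym (N∘adj R) ⟩
    N (adj R)         ≡⟨ cong N (cong₂ _,_ adj₁≡0 adj₂≡0) ⟩
    N (0ℚ , 0ℚ)       ≡⟨ cong₂ _,_ (origin p₁ q₁) (origin p₂ q₂) ⟩
    (0ℚ , 0ℚ)         ∎))
    where
    open ≡-Reasoning
    origin : ∀ p q → 0ℚ * p + 0ℚ * q ≡ 0ℚ
    origin = solve-∀ ℚ-ring

  N-nonzero : ∀ {S} → NonzeroQ S → NonzeroQ (N S)
  N-nonzero {S} S≢0 (N₁≡0 , N₂≡0) = S≢0 (·-reflects-origin S D≢0 (begin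
    D · S             ≡⟨ sym (adj∘N S) ⟩
    adj (N S)         ≡⟨ cong adj (cong₂ _,_ N₁≡0 N₂≡0) ⟩
    adj (0ℚ , 0ℚ)     ≡⟨ cong₂ _,_ (origin q₂ q₁) (origin p₁ p₂) ⟩
    (0ℚ , 0ℚ)         ∎))
    where
    open ≡-Reasoning
    origin : ∀ p q → p * 0ℚ - q * 0ℚ ≡ 0ℚ
    origin = solve-∀ ℚ-ring

  adj∼⇒∼N : ∀ R S → adj R ∼ S → R ∼ N S
  adj∼⇒∼N R S adjR∼S =
    adj-reflects-∼ (subst₂ _∼_ (1·v≡v (adj R)) (sym (adj∘N S)) (·-∼ 1ℚ D (adj R) S adjR∼S))

  ∼N⇒adj∼ : ∀ R S → R ∼ N S → adj R ∼ S
  ∼N⇒adj∼ R S R∼NS =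
    ·-reflects-∼ (adj R) S ℚP.1≢0 D≢0 (subst₂ _∼_ (sym (1·v≡v (adj R))) (adj∘N S) (adj-∼ R∼NS))

  N-reflects-∼ : ∀ S S′ → N S ∼ N S′ → S ∼ S′
  N-reflects-∼ S S′ NS∼NS′ = ·-reflects-∼ S S′ D≢0 D≢0 (subst₂ _∼_ (adj∘N S) (adj∘N S′) (adj-∼ NS∼NS′))

  open QuadMap φ

  private
    form₁ form₂ : ℚ² → ℚ
    form₁ (x , y) = a * (x * x) + b * (x * y) + c * (y * y)
    form₂ (x , y) = d * (x * x) + e * (x * y) + f * (y * y)
    polar₁ polar₂ : ℚ
    polar₁ = a * (p₁ * q₁ + p₁ * q₁) + b * (p₁ * q₂ + q₁ * p₂) + c * (p₂ * q₂ + p₂ * q₂)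
    polar₂ = d * (p₁ * q₁ + p₁ * q₁) + e * (p₁ * q₂ + q₁ * p₂) + f * (p₂ * q₂ + p₂ * q₂)

  -- adj ∘ φ ∘ N, expanded as a quadratic map; adj is N⁻¹ up to the scalar D
  ψ : QuadMap
  ψ = quad (q₂ * form₁ P - q₁ * form₂ P) (q₂ * polar₁ - q₁ * polar₂) (q₂ * form₁ Q - q₁ * form₂ Q)
           (p₁ * form₂ P - p₂ * form₁ P) (p₁ * polar₂ - p₂ * polar₁) (p₁ * form₂ Q - p₂ * form₁ Q)

  ψ-apply : ∀ S → applyQ ψ S ≡ adj (applyQ φ (N S))
  ψ-apply (s , t) = cong₂ _,_
    (trans (combine q₂ q₁ (form₁ P) polar₁ (form₁ Q) (form₂ P) polar₂ (form₂ Q) s t)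
      (sym (cong₂ (λ X Y → q₂ * X - q₁ * Y) (expand a b c p₁ p₂ q₁ q₂ s t) (expand d e f p₁ p₂ q₁ q₂ s t))))
    (trans (combine p₁ p₂ (form₂ P) polar₂ (form₂ Q) (form₁ P) polar₁ (form₁ Q) s t)
      (sym (cong₂ (λ X Y → p₁ * Y - p₂ * X) (expand a b c p₁ p₂ q₁ q₂ s t) (expand d e f p₁ p₂ q₁ q₂ s t))))
    where
    expand : ∀ a b c p₁ p₂ q₁ q₂ s t →
      a * ((s * p₁ + t * q₁) * (s * p₁ + t * q₁)) + b * ((s * p₁ + t * q₁) * (s * p₂ + t * q₂)) + c * ((s * p₂ + t * q₂) * (s * p₂ + t * q₂))
      ≡ (a * (p₁ * p₁) + b * (p₁ * p₂) + c * (p₂ * p₂)) * (s * s)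
        + (a * (p₁ * q₁ + p₁ * q₁) + b * (p₁ * q₂ + q₁ * p₂) + c * (p₂ * q₂ + p₂ * q₂)) * (s * t)
        + (a * (q₁ * q₁) + b * (q₁ * q₂) + c * (q₂ * q₂)) * (t * t)
    expand = solve-∀ ℚ-ring
    combine : ∀ u v X₁ Y₁ Z₁ X₂ Y₂ Z₂ s t →
      (u * X₁ - v * X₂) * (s * s) + (u * Y₁ - v * Y₂) * (s * t) + (u * Z₁ - v * Z₂) * (t * t)
      ≡ u * (X₁ * (s * s) + Y₁ * (s * t) + Z₁ * (t * t)) - v * (X₂ * (s * s) + Y₂ * (s * t) + Z₂ * (t * t))
    combine = solve-∀ ℚ-ring

  ψ-adj : ∀ R → applyQ ψ (adj R) ≡ (D * D) · adj (applyQ φ R)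
  ψ-adj R = begin
    applyQ ψ (adj R)                 ≡⟨ ψ-apply (adj R) ⟩
    adj (applyQ φ (N (adj R)))       ≡⟨ cong (λ S → adj (applyQ φ S)) (N∘adj R) ⟩
    adj (applyQ φ (D · R))           ≡⟨ cong adj (applyQ-· φ D R) ⟩
    adj ((D * D) · applyQ φ R)       ≡⟨ adj-· (D * D) (applyQ φ R) ⟩
    (D * D) · adj (applyQ φ R)       ∎
    where open ≡-Reasoning

  iterQ-ψ-adj : ∀ k R → ∃ λ μ → iterQ ψ k (adj R) ≡ μ · adj (iterQ φ k R)
  iterQ-ψ-adj zero    R = 1ℚ , sym (1·v≡v (adj R))
  iterQ-ψ-adj (suc k) R with iterQ-ψ-adj k R
  ... | μ , ψᵏadjR≡μadjφᵏR = μ * μ * (D * D) , (begin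
    applyQ ψ (iterQ ψ k (adj R))               ≡⟨ cong (applyQ ψ) ψᵏadjR≡μadjφᵏR ⟩
    applyQ ψ (μ · adj φᵏR)                     ≡⟨ applyQ-· ψ μ (adj φᵏR) ⟩
    (μ * μ) · applyQ ψ (adj φᵏR)               ≡⟨ cong ((μ * μ) ·_) (ψ-adj φᵏR) ⟩
    (μ * μ) · (D * D) · adj (applyQ φ φᵏR)     ≡⟨ ·-assoc (μ * μ) (D * D) (adj (applyQ φ φᵏR)) ⟩
    (μ * μ * (D * D)) · adj (applyQ φ φᵏR)     ∎)
    where
    open ≡-Reasoning
    φᵏR : ℚ²
    φᵏR = iterQ φ k R

  Fixed-adj : ∀ {R} → Fixed φ R → Fixed ψ (adj R)
  Fixed-adj {R} φR∼R =
    subst₂ _∼_ (sym (ψ-adj R)) (1·v≡v (adj R)) (·-∼ (D * D) 1ℚ (adj (applyQ φ R)) (adj R) (adj-∼ φR∼R))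

  ψ∼⇒φN∼N : ∀ S T → applyQ ψ S ∼ T → applyQ φ (N S) ∼ N T
  ψ∼⇒φN∼N S T ψS∼T = adj∼⇒∼N (applyQ φ (N S)) T (subst (_∼ T) (ψ-apply S) ψS∼T)

  φN∼N⇒ψ∼ : ∀ S T → applyQ φ (N S) ∼ N T → applyQ ψ S ∼ T
  φN∼N⇒ψ∼ S T φNS∼NT = subst (_∼ T) (sym (ψ-apply S)) (∼N⇒adj∼ (applyQ φ (N S)) T φNS∼NT)

  Preperiodic-adj : ∀ {R} → Preperiodic φ R → Preperiodic ψ (adj R)
  Preperiodic-adj {R} (m , n , m≢n , φᵐR∼φⁿR) with iterQ-ψ-adj m R | iterQ-ψ-adj n R
  ... | μ , ψᵐ≡ | ν , ψⁿ≡ = m , n , m≢n , subst₂ _∼_ (sym ψᵐ≡) (sym ψⁿ≡) (·-∼ μ ν (adj (iterQ φ m R)) (adj (iterQ φ n R)) (adj-∼ φᵐR∼φⁿR))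

  adj∼P∞⇒∼P : ∀ {R} → adj R ∼ P∞ → R ∼ P
  adj∼P∞⇒∼P {R} adjR∼P∞ = subst (R ∼_) N-P∞ (adj∼⇒∼N R P∞ adjR∼P∞)

  adj∼P₀⇒∼Q : ∀ {R} → adj R ∼ P₀ → R ∼ Q
  adj∼P₀⇒∼Q {R} adjR∼P₀ = subst (R ∼_) N-P₀ (adj∼⇒∼N R P₀ adjR∼P₀)

  module _ (φ-nonzero : ∀ R → NonzeroQ R → NonzeroQ (applyQ φ R))
           (φP∼Q : applyQ φ P ∼ Q) (φQ∼P : applyQ φ Q ∼ P)
           (only-P↦Q : ∀ A → NonzeroQ A → applyQ φ A ∼ Q → A ∼ P)
           (only-Q↦P : ∀ A → NonzeroQ A → applyQ φ A ∼ P → A ∼ Q) where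

    ψ-normal-form : ∃ λ c → ∃ λ d → c ≢ 0ℚ × d ≢ 0ℚ × ψ ≡ ψ[ c , d ]
    ψ-normal-form = swap-normal-form ψ ψ-nonzero
      (φN∼N⇒ψ∼ P∞ P₀ (subst₂ _∼_ (cong (applyQ φ) (sym N-P∞)) (sym N-P₀) φP∼Q))
      (φN∼N⇒ψ∼ P₀ P∞ (subst₂ _∼_ (cong (applyQ φ) (sym N-P₀)) (sym N-P∞) φQ∼P))
      (λ S S≢0 ψS∼P₀ → N-reflects-∼ S P∞ (subst (N S ∼_) (sym N-P∞)
         (only-P↦Q (N S) (N-nonzero S≢0) (subst (applyQ φ (N S) ∼_) N-P₀ (ψ∼⇒φN∼N S P₀ ψS∼P₀)))))
      (λ S S≢0 ψS∼P∞ → N-reflects-∼ S P₀ (subst (N S ∼_) (sym N-P₀)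
         (only-Q↦P (N S) (N-nonzero S≢0) (subst (applyQ φ (N S) ∼_) N-P∞ (ψ∼⇒φN∼N S P∞ ψS∼P∞)))))
      where
      ψ-nonzero : ∀ S → NonzeroQ S → NonzeroQ (applyQ ψ S)
      ψ-nonzero S S≢0 = subst NonzeroQ (sym (ψ-apply S)) (adj-nonzero (φ-nonzero (N S) (N-nonzero S≢0)))

  classification-transport : PreperiodicClassification ψ P∞ P₀ → PreperiodicClassification φ P Q
  classification-transport (inj₁ (no-fixed , only-cycle)) = inj₁
    ( (λ R R≢0 → no-fixed (adj R) (adj-nonzero R≢0) ∘ Fixed-adj)
    , (λ R R≢0 → map adj∼P∞⇒∼P adj∼P₀⇒∼Q ∘ only-cycle (adj R) (adj-nonzero R≢0) ∘ Preperiodic-adj) )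
  classification-transport (inj₂ (F , F≢0 , F-fixed , only-F , T , T≢0 , T-not-fixed , ψT∼F , only-cycle-F-T)) = inj₂
    ( N F , N-nonzero F≢0 , ψ∼⇒φN∼N F F F-fixed
    , (λ R R≢0 → adj∼⇒∼N R F ∘ only-F (adj R) (adj-nonzero R≢0) ∘ Fixed-adj)
    , N T , N-nonzero T≢0 , T-not-fixed ∘ φN∼N⇒ψ∼ T T , ψ∼⇒φN∼N T F ψT∼F
    , (λ R R≢0 → map adj∼P∞⇒∼P (map adj∼P₀⇒∼Q (map (adj∼⇒∼N R F) (adj∼⇒∼N R T)))
                 ∘ only-cycle-F-T (adj R) (adj-nonzero R≢0) ∘ Preperiodic-adj) )

proposition5p4 : ∀ {c ℓ : Level} (Qbar : AlgebraicClosureOfℚ c ℓ) (φ : QuadMap) →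
    NoCommonZero Qbar φ →
    ConjugateToψ₂ Qbar φ →
    (P Q : ℚ²) → NonzeroQ P → NonzeroQ Q → ¬ (P ∼ Q) →
    applyQ φ P ∼ Q → applyQ φ Q ∼ P →
    ((∀ R → NonzeroQ R → ¬ Fixed φ R) ×
     (∀ R → NonzeroQ R → Preperiodic φ R → (R ∼ P) ⊎ (R ∼ Q)))
    ⊎
    (∃ λ F → NonzeroQ F × Fixed φ F ×
      (∀ R → NonzeroQ R → Fixed φ R → R ∼ F) ×
      (∃ λ T → NonzeroQ T × ¬ Fixed φ T × (applyQ φ T ∼ F) ×
        (∀ R → NonzeroQ R → Preperiodic φ R →
          (R ∼ P) ⊎ (R ∼ Q) ⊎ (R ∼ F) ⊎ (R ∼ T))))
proposition5p4 Qbar φ φ≉0 conjugate P Q P≢0 Q≢0 P≁Q φP∼Q φQ∼P =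
  let c , d , c≢0 , d≢0 , ψ≡ψ[c,d] = ψ-normal-form (NoCommonZero⇒nonzero-on-ℚ φ φ≉0) φP∼Q φQ∼P only-P↦Q only-Q↦P
  in classification-transport (subst (λ ψ → PreperiodicClassification ψ P∞ P₀) (sym ψ≡ψ[c,d])
       (InverseSquareNormalForm.normal-form-classification c d c≢0 d≢0))
  where
  open OverAlgebraicClosure Qbar using (NoCommonZero⇒nonzero-on-ℚ; two-cycle-unique-preimage)
  open ChangeOfCoordinates φ (proj₁ P) (proj₂ P) (proj₁ Q) (proj₂ Q) P≁Q using (ψ-normal-form; classification-transport)
  only-P↦Q : ∀ A → NonzeroQ A → applyQ φ A ∼ Q → A ∼ P
  only-P↦Q = two-cycle-unique-preimage φ φ≉0 conjugate P Q P≢0 Q≢0 P≁Q φP∼Q φQ∼P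
  only-Q↦P : ∀ A → NonzeroQ A → applyQ φ A ∼ P → A ∼ Q
  only-Q↦P = two-cycle-unique-preimage φ φ≉0 conjugate Q P Q≢0 P≢0 (P≁Q ∘ sym) φQ∼P φP∼Q
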